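{- The words $\mathbf{x}=f^\omega(0)$ and $\mathbf{y}=g(f^\omega(0))$ are rich.
   Context: $f(0)=01$, $f(1)=022$, $f(2)=02$; $g(0)=20$, $g(1)=21$, $g(2)=2$ on $\{0,1,2\}$; $f^\omega(0)$ is the fixed point of $f$ beginning with $0$. An infinite word is rich if every finite factor of length $m$ has $m+1$ distinct palindromic factors (including the empty word). -}

module Defs where

open import Data.Nat using (ℕ; zero; suc; _+_)
open import Data.Fin using (Fin; zero; suc)
open import Data.List using (List; []; _∷_; _++_; concatMap; map; upTo; reverse; length)
open import Data.List.Relation.Unary.Unique.Propositional using (Unique)
open import Data.List.Membership.Propositional using (_∈_)
open import Data.Product using (Σ; ∃; _×_)
open import Function.Bundles using (_⇔_)
open import Relation.Binary.PropositionalEquality using (_≡_)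

Letter : Set
Letter = Fin 3

Word : Set
Word = List Letter

InfWord : Set
InfWord = ℕ → Letter

f : Letter → Word
f zero = zero ∷ suc zero ∷ []
f (suc zero) = zero ∷ suc (suc zero) ∷ suc (suc zero) ∷ []
f (suc (suc zero)) = zero ∷ suc (suc zero) ∷ []

g : Letter → Word
g zero = suc (suc zero) ∷ zero ∷ []
g (suc zero) = suc (suc zero) ∷ suc zero ∷ []
g (suc (suc zero)) = suc (suc zero) ∷ []

morph : (Letter → Word) → Word → Word
morph h w = concatMap h w

iterate : ℕ → (Word → Word) → Word → Word
iterate zero φ w = w
iterate (suc k) φ w = φ (iterate k φ w)

nth : Word → ℕ → Letter → Letter
nth [] n d = d
nth (a ∷ w) zero d = a
nth (a ∷ w) (suc n) d = nth w n d

prefix : InfWord → ℕ → Word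
prefix x n = map x (upTo n)

-- f^ω(0): f^k(0) is a prefix of f^(k+1)(0) and has length ≥ k+1,
-- so the n-th letter of the fixed point is the n-th letter of f^(n+1)(0).
x : InfWord
x n = nth (iterate (suc n) (morph f) (zero ∷ [])) n zero

-- y = g(x): all images under g are nonempty, so g(prefix of length n+1)
-- has length ≥ n+1 and is a prefix of g(x).
y : InfWord
y n = nth (morph g (prefix x (suc n))) n zero

window : InfWord → ℕ → ℕ → Word
window w i m = map (λ k → w (i + k)) (upTo m)

IsFactor : Word → Word → Set
IsFactor u w = Σ Word λ p → Σ Word λ s → p ++ (u ++ s) ≡ w

IsPalindrome : Word → Set
IsPalindrome u = reverse u ≡ u

-- w has exactly k distinct palindromic factors (including the empty word)
NumPalFactors : Word → ℕ → Set
NumPalFactors w k = Σ (List Word) λ L →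
  Unique L × (∀ u → (u ∈ L) ⇔ (IsFactor u w × IsPalindrome u)) × length L ≡ k

Rich : InfWord → Set
Rich w = ∀ i m → NumPalFactors (window w i m) (suc m)

module Submission where

-- Richness is obtained from the criterion of Glen, Justin, Widmer and Zamboni: in a factor-closed
-- language in which every complete return word to a palindrome is a palindrome, extending a word u
-- to a ∷ u creates exactly one new palindromic factor, the longest palindromic prefix of a ∷ u
-- (it cannot reoccur in u, since its first reoccurrence would close a longer palindromic prefix),
-- so every word w of the language has |w| + 1 palindromic factors.
--
-- Both f and g have the shape a ↦ c q(a), where the blocks q(a) are distinct palindromes avoiding
-- the marker c. A complete return to a palindrome inside the image φ(U) c either lies within a
-- block, or is framed, t φ(N) c rev(t), exactly like the palindrome t φ(v) c rev(t) it returns to.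
-- Desubstituting gives a complete return in U to v, or to a short palindrome b v b determined by
-- the frame, and palindromicity lifts back through φ. For x = f(x) this is a strong induction on
-- the weight μ with μ(0) = 1 and μ(1) = μ(2) = 2, which strictly decreases under desubstitution;
-- for y = g(x) a single desubstitution lands in the factors of x.

open import Defs
open import Data.Nat using (ℕ; zero; suc; _+_; _∸_; _≤_; _<_; z≤n; s≤s; s≤s⁻¹)
open import Data.Nat.Properties
  using (≤-refl; ≤-trans; ≤-reflexive; n≤1+n; n<1+n; <-irrefl; <⇒≤; <⇒≱; ≤∧≢⇒<; <-cmp; ≤-<-trans; <-≤-trans;
         +-comm; +-assoc; m≤m+n; m≤n+m; m<m+n; m≤n⇒m⊓n≡m; m∸n+n≡m; +-mono-≤; +-monoˡ-≤; +-monoʳ-≤; +-monoʳ-<;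
         module ≤-Reasoning)
open import Data.Nat.Tactic.RingSolver using (solve-∀)
open import Data.Fin using (zero; suc; _≟_)
open import Data.List using (List; []; _∷_; _++_; [_]; length; reverse; map; upTo; applyUpTo; take; drop)
open import Data.List.Properties
  using (++-assoc; ++-identityʳ; ++-monoid; ≡-dec; ∷-injective; ∷-injectiveˡ; ∷-injectiveʳ; ∷ʳ-injective;
         ++-cancelˡ; ++-cancelʳ; ++-conicalˡ; ++-conicalʳ; length-++; length-take; length-map; length-applyUpTo;
         take++drop≡id; unfold-reverse)
open import Data.List.Relation.Unary.All using (All; []; _∷_; all?)
open import Data.List.Relation.Unary.All.Properties using (++⁺; ++⁻ˡ; ++⁻ʳ; ¬Any⇒All¬)
open import Data.List.Relation.Unary.Any using (here; there)
open import Data.List.Relation.Unary.AllPairs using ([]; _∷_)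
open import Data.List.Relation.Unary.Unique.Propositional using (Unique)
open import Data.Product using (Σ; _×_; _,_; proj₁; proj₂)
open import Data.Sum using (_⊎_; inj₁; inj₂)
open import Data.Empty using (⊥-elim)
open import Data.Unit using (⊤; tt)
open import Function using (_∘_)
open import Function.Bundles using (mk⇔)
open import Relation.Binary.Definitions using (tri<; tri≈; tri>)
open import Relation.Nullary using (¬_; Dec; yes; no; ¬?)
open import Relation.Binary.PropositionalEquality
  using (_≡_; _≢_; refl; sym; trans; cong; cong₂; subst; subst₂; module ≡-Reasoning)
open import Algebra.Solver.Monoid (++-monoid Letter) using (solve; _⊜_; _⊕_)

-- Words, palindromes and complete returns

pattern l0 = zero
pattern l1 = suc zero
pattern l2 = suc (suc zero)

-- Defined by structural recursion (unlike reverse) so that rev (a ∷ u) computes.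
rev : Word → Word
rev [] = []
rev (a ∷ u) = rev u ++ [ a ]

rev-++ : ∀ u v → rev (u ++ v) ≡ rev v ++ rev u
rev-++ [] v = sym (++-identityʳ (rev v))
rev-++ (a ∷ u) v rewrite rev-++ u v = ++-assoc (rev v) (rev u) [ a ]

rev-involutive : ∀ u → rev (rev u) ≡ u
rev-involutive [] = refl
rev-involutive (a ∷ u) rewrite rev-++ (rev u) [ a ] | rev-involutive u = refl

reverse≡rev : ∀ u → reverse u ≡ rev u
reverse≡rev [] = refl
reverse≡rev (a ∷ u) = trans (unfold-reverse a u) (cong (_++ [ a ]) (reverse≡rev u))

Palindrome : Word → Set
Palindrome u = rev u ≡ u

Palindrome⇒IsPalindrome : ∀ {u} → Palindrome u → IsPalindrome u
Palindrome⇒IsPalindrome {u} = trans (reverse≡rev u)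

IsPalindrome⇒Palindrome : ∀ {u} → IsPalindrome u → Palindrome u
IsPalindrome⇒Palindrome {u} = trans (sym (reverse≡rev u))

_≟ʷ_ : (u v : Word) → Dec (u ≡ v)
_≟ʷ_ = ≡-dec _≟_

palindrome? : (u : Word) → Dec (Palindrome u)
palindrome? u = rev u ≟ʷ u

Prefix : Word → Word → Set
Prefix p w = Σ Word λ s → w ≡ p ++ s

Factor : Word → Word → Set
Factor u w = Σ Word λ a → Σ Word λ b → w ≡ a ++ u ++ b

Factor⇒IsFactor : ∀ {u w} → Factor u w → IsFactor u w
Factor⇒IsFactor (a , b , e) = a , b , sym e

IsFactor⇒Factor : ∀ {u w} → IsFactor u w → Factor u w
IsFactor⇒Factor (a , b , e) = a , b , sym e

Factor-refl : ∀ {u} → Factor u u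
Factor-refl {u} = [] , [] , sym (++-identityʳ u)

Factor-trans : ∀ {u v w} → Factor u v → Factor v w → Factor u w
Factor-trans {u} (a , b , refl) (c , d , refl) = c ++ a , b ++ d ,
  solve 5 (λ C A U B D → C ⊕ (A ⊕ U ⊕ B) ⊕ D ⊜ (C ⊕ A) ⊕ U ⊕ (B ⊕ D)) refl c a u b d

Prefix⇒Factor : ∀ {u w} → Prefix u w → Factor u w
Prefix⇒Factor (s , e) = [] , s , e

CompleteReturn : Word → Word → Set
CompleteReturn p w =
  Prefix p w × (Σ Word λ a → w ≡ a ++ p) × (∀ a b → w ≡ a ++ p ++ b → a ≡ [] ⊎ b ≡ [])

FactorClosed : (Word → Set) → Set
FactorClosed L = ∀ u w → Factor u w → L w → L u

ReturnsPalindromic : (Word → Set) → Set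
ReturnsPalindromic L = ∀ p w → Palindrome p → L w → CompleteReturn p w → Palindrome w

Prefix⇒take : ∀ {q w} → Prefix q w → q ≡ take (length q) w
Prefix⇒take {[]} _ = refl
Prefix⇒take {a ∷ q} (s , refl) = cong (a ∷_) (Prefix⇒take (s , refl))

Prefix-shorter : ∀ {x y w} → Prefix x w → Prefix y w → length x ≤ length y → Prefix x y
Prefix-shorter {[]} {y} _ _ _ = y , refl
Prefix-shorter {a ∷ x} {b ∷ y} (s , refl) (t , e) (s≤s le) with refl , e′ ← ∷-injective e
  = let r , e″ = Prefix-shorter (s , refl) (t , e′) le in r , cong (a ∷_) e″

Prefix-unique : ∀ {x y w} → Prefix x w → Prefix y w → length x ≡ length y → x ≡ y
Prefix-unique px py e = trans (Prefix⇒take px) (trans (cong (λ n → take n _) e) (sym (Prefix⇒take py)))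

Prefix-≢[] : ∀ p t → p ≢ [] → Prefix p t → t ≢ []
Prefix-≢[] [] t ne _ = ⊥-elim (ne refl)
Prefix-≢[] (x ∷ p) .[] ne (s , ()) refl

Suffix-≢[] : ∀ p t2 → p ≢ [] → (Σ Word λ a → t2 ≡ a ++ p) → t2 ≢ []
Suffix-≢[] p t2 ne (a , e) refl = ne (++-conicalʳ a p (sym e))

CompleteReturn-[]⇒Palindrome : ∀ w → CompleteReturn [] w → Palindrome w
CompleteReturn-[]⇒Palindrome [] _ = refl
CompleteReturn-[]⇒Palindrome (a ∷ []) _ = refl
CompleteReturn-[]⇒Palindrome (a ∷ b ∷ w) (_ , _ , once) with once [ a ] (b ∷ w) refl
... | inj₁ ()
... | inj₂ ()

constant⇒Palindrome : ∀ a w → All (_≡ a) w → Palindrome w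
constant⇒Palindrome a [] _ = refl
constant⇒Palindrome a (b ∷ w) (refl ∷ as) =
  trans (cong (_++ [ a ]) (constant⇒Palindrome a w as)) (snoc-constant w as)
  where
  snoc-constant : ∀ w → All (_≡ a) w → w ++ [ a ] ≡ a ∷ w
  snoc-constant [] _ = refl
  snoc-constant (b ∷ w) (refl ∷ as) = cong (a ∷_) (snoc-constant w as)

All-Factor : ∀ {P : Letter → Set} {u w} → Factor u w → All P w → All P u
All-Factor {u = u} (a , b , refl) all = ++⁻ˡ u (++⁻ʳ a all)

length-Factor : ∀ {u w} → Factor u w → length u ≤ length w
length-Factor {u} (a , b , refl) = begin
  length u                  ≤⟨ m≤m+n (length u) (length b) ⟩
  length u + length b       ≡⟨ length-++ u ⟨
  length (u ++ b)           ≤⟨ m≤n+m (length (u ++ b)) (length a) ⟩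
  length a + length (u ++ b) ≡⟨ length-++ a ⟨
  length (a ++ u ++ b)      ∎
  where open ≤-Reasoning

unsnoc : ∀ (d : Word) → d ≢ [] → Σ Word λ d' → Σ Letter λ y → d ≡ d' ++ [ y ]
unsnoc [] ne = ⊥-elim (ne refl)
unsnoc (x ∷ []) _ = [] , x , refl
unsnoc (x ∷ (x' ∷ d)) _ with unsnoc (x' ∷ d) (λ ())
... | d' , y , e = x ∷ d' , y , cong (x ∷_) e

strip-ends : ∀ b N b' a Y d → b ∷ N ++ [ b' ] ≡ a ++ Y ++ d → a ≢ [] → d ≢ [] →
  Σ Word λ a' → Σ Word λ d' → (a ≡ b ∷ a') × (d ≡ d' ++ [ b' ]) × (N ≡ a' ++ Y ++ d')
strip-ends b N b' [] Y d e na nd = ⊥-elim (na refl)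
strip-ends b N b' (x ∷ a') Y d e na nd with ∷-injective e
... | refl , e2 with unsnoc d nd
... | d' , y , refl with ∷ʳ-injective N (a' ++ Y ++ d')
    (trans e2 (solve 4 (λ A Y D S → A ⊕ Y ⊕ (D ⊕ S) ⊜ (A ⊕ Y ⊕ D) ⊕ S) refl a' Y d' [ y ]))
... | eN , refl = a' , d' , refl , refl , eN

Palindrome-inner : ∀ b N b' → Palindrome (b ∷ N ++ [ b' ]) → Palindrome N
Palindrome-inner b N b' p = proj₁ (∷ʳ-injective (rev N) N
    (∷-injectiveʳ (trans (sym (cong (_++ [ b ]) (rev-++ N [ b' ]))) p)))

-- The richness criterion

open import Data.List.Membership.DecPropositional _≟ʷ_ using (_∈_; _∈?_)

Prefix-take : ∀ n w → Prefix (take n w) w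
Prefix-take n w = drop n w , sym (take++drop≡id n w)

Factor-∷ : ∀ {z a u} → Factor z (a ∷ u) → Prefix z (a ∷ u) ⊎ Factor z u
Factor-∷ ([] , b , e) = inj₁ (b , e)
Factor-∷ (_ ∷ α , b , e) = inj₂ (α , b , ∷-injectiveʳ e)

Factor-tail : ∀ {z a u} → Factor z u → Factor z (a ∷ u)
Factor-tail {a = a} (α , β , e) = a ∷ α , β , cong (a ∷_) e

Factor-[] : ∀ {z} → Factor z [] → z ≡ []
Factor-[] {[]} _ = refl
Factor-[] {_ ∷ _} ([] , _ , ())
Factor-[] {_ ∷ _} (_ ∷ _ , _ , ())

prefix? : ∀ p u → Dec (Prefix p u)
prefix? [] u = yes (u , refl)
prefix? (a ∷ p) [] = no λ ()
prefix? (a ∷ p) (b ∷ u) with a ≟ b | prefix? p u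
... | yes refl | yes (s , e) = yes (s , cong (a ∷_) e)
... | yes refl | no ¬p = no λ (s , e) → ¬p (s , ∷-injectiveʳ e)
... | no a≢b | _ = no λ (s , e) → a≢b (sym (∷-injectiveˡ e))

LongestPalPrefix : Word → Set
LongestPalPrefix w =
  Σ Word λ p → Palindrome p × Prefix p w × (∀ q → Palindrome q → Prefix q w → length q ≤ length p)

longestPalPrefix : ∀ w → LongestPalPrefix w
longestPalPrefix w = search (length w) ≤-refl (λ q _ → length-Factor ∘ Prefix⇒Factor)
  where
  search : ∀ n → n ≤ length w → (∀ q → Palindrome q → Prefix q w → length q ≤ n) → LongestPalPrefix w
  search n n≤ bound with palindrome? (take n w)
  ... | yes pal = take n w , pal , Prefix-take n w , λ q pq prq →
    subst (length q ≤_) (sym (trans (length-take n w) (m≤n⇒m⊓n≡m n≤))) (bound q pq prq)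
  search zero _ _ | no ¬pal = ⊥-elim (¬pal refl)
  search (suc n) n≤ bound | no ¬pal = search n (≤-trans (n≤1+n n) n≤) λ q pq prq →
    s≤s⁻¹ (≤∧≢⇒< (bound q pq prq) λ e →
      ¬pal (subst Palindrome (trans (Prefix⇒take prq) (cong (λ k → take k w) e)) pq))

lpp : Word → Word
lpp w = proj₁ (longestPalPrefix w)

-- A palindromic prefix z strictly shorter than a palindromic prefix p is also a suffix of p.
palPrefix-shorter⇒Factor-tail : ∀ {z p a u} → Palindrome z → Palindrome p →
  Prefix z (a ∷ u) → Prefix p (a ∷ u) → length z < length p → Factor z u
palPrefix-shorter⇒Factor-tail {z} {p} {a} {u} pz pp prz (t , et) lt =
  let s , e = Prefix-shorter prz (t , et) (<⇒≤ lt)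
  in reoccur (rev s) (trans (sym pp) (trans (cong rev e) (trans (rev-++ z s) (cong (rev s ++_) pz))))
  where
  reoccur : ∀ r → p ≡ r ++ z → Factor z u
  reoccur [] e = ⊥-elim (<-irrefl (cong length (sym e)) lt)
  reoccur (x ∷ r) e = r , t , trans (∷-injectiveʳ (trans et (cong (_++ t) e))) (++-assoc r z t)

palFactor-∷ : ∀ {z a u} → Factor z (a ∷ u) → Palindrome z → Factor z u ⊎ z ≡ lpp (a ∷ u)
palFactor-∷ {z} {a} {u} fz pz with longestPalPrefix (a ∷ u) | Factor-∷ fz
... | _ | inj₂ f = inj₁ f
... | p , pp , prp , longest | inj₁ prz with <-cmp (length z) (length p)
... | tri< z<p _ _ = inj₁ (palPrefix-shorter⇒Factor-tail pz pp prz prp z<p)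
... | tri≈ _ z≡p _ = inj₂ (Prefix-unique prz prp z≡p)
... | tri> _ _ p<z = ⊥-elim (<⇒≱ p<z (longest z pz prz))

FirstOccurrence : Word → Word → Set
FirstOccurrence p u = Σ Word λ α → Σ Word λ β →
  u ≡ α ++ p ++ β × (∀ α′ β′ → u ≡ α′ ++ p ++ β′ → length α ≤ length α′)

firstOccurrence : ∀ {p u} α β → u ≡ α ++ p ++ β → FirstOccurrence p u
firstOccurrence {p} {u} α β e with prefix? p u
... | yes (s , es) = [] , s , es , λ _ _ _ → z≤n
firstOccurrence {p} {[]} [] β e | no ¬pre = ⊥-elim (¬pre (β , e))
firstOccurrence {p} {b ∷ u} [] β e | no ¬pre = ⊥-elim (¬pre (β , e))
firstOccurrence {p} {b ∷ u} (_ ∷ α) β e | no ¬pre =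
  let α₀ , β₀ , e₀ , first = firstOccurrence α β (∷-injectiveʳ e)
  in b ∷ α₀ , β₀ , cong (b ∷_) e₀ , λ where
       [] β′ e′ → ⊥-elim (¬pre (β′ , e′))
       (_ ∷ α′) β′ e′ → s≤s (first α′ β′ (∷-injectiveʳ e′))

-- If the longest palindromic prefix p of a ∷ u reoccurred in u, then a ∷ u would have a prefix
-- which is a complete return to p, hence a palindrome longer than p.
lpp-unioccurrent : ∀ {L} → FactorClosed L → ReturnsPalindromic L →
  ∀ a u → L (a ∷ u) → ¬ Factor (lpp (a ∷ u)) u
lpp-unioccurrent {L} closed palReturns a u Lau (α , β , e) with longestPalPrefix (a ∷ u)
... | p , pp , prp , longest =
  let α₀ , β₀ , e₀ , first = firstOccurrence α β e
      w = a ∷ α₀ ++ p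
      w-prefix : Prefix w (a ∷ u)
      w-prefix = β₀ , cong (a ∷_) (trans e₀ (sym (++-assoc α₀ p β₀)))
      |p|<|w| : length p < length w
      |p|<|w| = s≤s (≤-trans (m≤n+m (length p) (length α₀)) (≤-reflexive (sym (length-++ α₀))))
      once : ∀ c d → w ≡ c ++ p ++ d → c ≡ [] ⊎ d ≡ []
      once = λ where
        [] d _ → inj₁ refl
        (_ ∷ c) [] _ → inj₂ refl
        (_ ∷ c) (y ∷ d) e′ → ⊥-elim (reoccurs-earlier α₀ β₀ e₀ first c y d (∷-injectiveʳ e′))
      return : CompleteReturn p w
      return = Prefix-shorter prp w-prefix (<⇒≤ |p|<|w|) , (a ∷ α₀ , refl) , once
  in <⇒≱ |p|<|w| (longest w (palReturns p w pp (closed w (a ∷ u) (Prefix⇒Factor w-prefix) Lau) return) w-prefix)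
  where
  reoccurs-earlier : ∀ α₀ β₀ → u ≡ α₀ ++ p ++ β₀ → (∀ α′ β′ → u ≡ α′ ++ p ++ β′ → length α₀ ≤ length α′) →
    ∀ c y d → α₀ ++ p ≢ c ++ p ++ y ∷ d
  reoccurs-earlier α₀ β₀ e₀ first c y d e′ = <⇒≱ longer shorter
    where
    open ≤-Reasoning
    u≡ : u ≡ c ++ p ++ y ∷ d ++ β₀
    u≡ = trans e₀ (trans (sym (++-assoc α₀ p β₀)) (trans (cong (_++ β₀) e′)
      (solve 4 (λ C P D B → (C ⊕ P ⊕ D) ⊕ B ⊜ C ⊕ P ⊕ (D ⊕ B)) refl c p (y ∷ d) β₀)))
    shorter : length (α₀ ++ p) ≤ length (c ++ p)
    shorter = begin
      length (α₀ ++ p)    ≡⟨ length-++ α₀ ⟩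
      length α₀ + length p ≤⟨ +-monoˡ-≤ (length p) (first c (y ∷ d ++ β₀) u≡) ⟩
      length c + length p  ≡⟨ length-++ c ⟨
      length (c ++ p)     ∎
    longer : length (c ++ p) < length (α₀ ++ p)
    longer = begin-strict
      length (c ++ p)                   <⟨ m<m+n (length (c ++ p)) (s≤s z≤n) ⟩
      length (c ++ p) + length (y ∷ d)   ≡⟨ length-++ (c ++ p) ⟨
      length ((c ++ p) ++ y ∷ d)         ≡⟨ cong length (trans (++-assoc c p (y ∷ d)) (sym e′)) ⟩
      length (α₀ ++ p)                  ∎

palFactors : Word → List Word
palFactors [] = [ [] ]
palFactors (a ∷ u) with lpp (a ∷ u) ∈? palFactors u
... | yes _ = palFactors u
... | no _ = lpp (a ∷ u) ∷ palFactors u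

palFactors-unique : ∀ w → Unique (palFactors w)
palFactors-unique [] = [] ∷ []
palFactors-unique (a ∷ u) with lpp (a ∷ u) ∈? palFactors u
... | yes _ = palFactors-unique u
... | no ∉ = ¬Any⇒All¬ _ ∉ ∷ palFactors-unique u

∈-palFactors⇒palFactor : ∀ {z} w → z ∈ palFactors w → Factor z w × Palindrome z
∈-palFactors⇒palFactor [] (here refl) = Factor-refl , refl
∈-palFactors⇒palFactor [] (there ())
∈-palFactors⇒palFactor (a ∷ u) z∈ with lpp (a ∷ u) ∈? palFactors u | z∈
... | yes _ | z∈u = let f , pz = ∈-palFactors⇒palFactor u z∈u in Factor-tail f , pz
... | no _ | there z∈u = let f , pz = ∈-palFactors⇒palFactor u z∈u in Factor-tail f , pz
... | no _ | here refl =
  let _ , pal , prefix , _ = longestPalPrefix (a ∷ u) in Prefix⇒Factor prefix , pal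

palFactor⇒∈-palFactors : ∀ {z} w → Factor z w → Palindrome z → z ∈ palFactors w
palFactor⇒∈-palFactors [] f _ = here (Factor-[] f)
palFactor⇒∈-palFactors (a ∷ u) f pz with lpp (a ∷ u) ∈? palFactors u | palFactor-∷ f pz
... | yes _ | inj₁ fu = palFactor⇒∈-palFactors u fu pz
... | no _ | inj₁ fu = there (palFactor⇒∈-palFactors u fu pz)
... | yes lpp∈ | inj₂ refl = lpp∈
... | no _ | inj₂ refl = here refl

length-palFactors : ∀ {L} → FactorClosed L → ReturnsPalindromic L → ∀ w → L w →
  length (palFactors w) ≡ suc (length w)
length-palFactors closed palReturns [] _ = refl
length-palFactors closed palReturns (a ∷ u) Lau with lpp (a ∷ u) ∈? palFactors u
... | yes lpp∈ = ⊥-elim (lpp-unioccurrent closed palReturns a u Lau (proj₁ (∈-palFactors⇒palFactor u lpp∈)))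
... | no _ = cong suc (length-palFactors closed palReturns u (closed u (a ∷ u) (Factor-tail Factor-refl) Lau))

returnsPalindromic⇒rich : ∀ {L} → FactorClosed L → ReturnsPalindromic L → ∀ w → L w →
  NumPalFactors w (suc (length w))
returnsPalindromic⇒rich closed palReturns w Lw =
  palFactors w , palFactors-unique w ,
  (λ z → mk⇔ (λ z∈ → let f , pz = ∈-palFactors⇒palFactor w z∈ in Factor⇒IsFactor f , Palindrome⇒IsPalindrome pz)
             (λ (f , pz) → palFactor⇒∈-palFactors w (IsFactor⇒Factor f) (IsPalindrome⇒Palindrome pz))) ,
  length-palFactors closed palReturns w Lw

-- Windows of infinite words

map-applyUpTo : ∀ (h : ℕ → Letter) f m → map h (applyUpTo f m) ≡ applyUpTo (h ∘ f) m
map-applyUpTo h f zero = refl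
map-applyUpTo h f (suc m) = cong (h (f 0) ∷_) (map-applyUpTo h (f ∘ suc) m)

length-window : ∀ w i m → length (window w i m) ≡ m
length-window w i m = trans (length-map (λ k → w (i + k)) (upTo m)) (length-applyUpTo (λ k → k) m)

Prefix-trans : ∀ {u v w} → Prefix u v → Prefix v w → Prefix u w
Prefix-trans {u} (s , refl) (t , refl) = s ++ t , ++-assoc u s t

nth-Prefix : ∀ u w n d → Prefix u w → n < length u → nth u n d ≡ nth w n d
nth-Prefix (a ∷ u) w zero d (s , refl) _ = refl
nth-Prefix (a ∷ u) w (suc n) d (s , refl) (s≤s lt) = nth-Prefix u (u ++ s) n d (s , refl) lt

nth-drop : ∀ i (W : Word) k d → nth (drop i W) k d ≡ nth W (i + k) d
nth-drop zero W k d = refl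
nth-drop (suc i) [] k d = refl
nth-drop (suc i) (a ∷ W) k d = nth-drop i W k d

≤-length-drop : ∀ i (W : Word) m → i + m ≤ length W → m ≤ length (drop i W)
≤-length-drop zero W m le = le
≤-length-drop (suc i) [] m ()
≤-length-drop (suc i) (a ∷ W) m (s≤s le) = ≤-length-drop i W m le

applyUpTo-Prefix : ∀ (h : ℕ → Letter) m W → (∀ k → k < m → h k ≡ nth W k l0) → m ≤ length W →
  Prefix (applyUpTo h m) W
applyUpTo-Prefix h zero W _ _ = W , refl
applyUpTo-Prefix h (suc m) [] _ ()
applyUpTo-Prefix h (suc m) (a ∷ W) agree (s≤s le) =
  let s , e = applyUpTo-Prefix (h ∘ suc) m W (λ k lt → agree (suc k) (s≤s lt)) le
  in s , trans (cong (_∷ W) (sym (agree 0 (s≤s z≤n)))) (cong (h 0 ∷_) e)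

window-Factor : ∀ w (W : Word) i m → (∀ k → k < m → w (i + k) ≡ nth W (i + k) l0) → i + m ≤ length W →
  Factor (window w i m) W
window-Factor w W i m agree le =
  let s , e = applyUpTo-Prefix (λ k → w (i + k)) m (drop i W)
                (λ k lt → trans (agree k lt) (sym (nth-drop i W k l0))) (≤-length-drop i W m le)
  in take i W , s , trans (sym (take++drop≡id i W))
       (cong (take i W ++_) (trans e (cong (_++ s) (sym (map-applyUpTo (λ k → w (i + k)) (λ k → k) m)))))

windows⇒rich : ∀ {L} → FactorClosed L → ReturnsPalindromic L → ∀ w → (∀ i m → L (window w i m)) → Rich w
windows⇒rich closed palReturns w inL i m = subst (λ n → NumPalFactors (window w i m) (suc n))
    (length-window w i m)
  (returnsPalindromic⇒rich closed palReturns (window w i m) (inL i m))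

-- Morphisms a ↦ c q(a) whose blocks q(a) are distinct palindromes avoiding the marker letter c;
-- both f (c = 0) and g (c = 2) have this form.
module Marker (c : Letter) (q : Letter → Word)
  (q-markerFree : ∀ a → All (_≢ c) (q a))
  (q-palindrome : ∀ a → Palindrome (q a))
  (q-injective : ∀ a b → q a ≡ q b → a ≡ b) where

  MarkerFree : Word → Set
  MarkerFree w = All (_≢ c) w

  φ : Word → Word
  φ [] = []
  φ (a ∷ u) = c ∷ (q a ++ φ u)

  Φ : Word → Word
  Φ u = φ u ++ [ c ]

  φ-++ : ∀ u v → φ (u ++ v) ≡ φ u ++ φ v
  φ-++ [] v = refl
  φ-++ (a ∷ u) v = cong (c ∷_) (trans (cong (q a ++_) (φ-++ u v)) (sym (++-assoc (q a) (φ u) (φ v))))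

  MarkerFree-rev : ∀ {w} → MarkerFree w → MarkerFree (rev w)
  MarkerFree-rev [] = []
  MarkerFree-rev (p ∷ ps) = ++⁺ (MarkerFree-rev ps) (p ∷ [])

  ¬MarkerFree-++-∷ : ∀ x y → ¬ MarkerFree (x ++ c ∷ y)
  ¬MarkerFree-++-∷ [] y (p ∷ _) = p refl
  ¬MarkerFree-++-∷ (a ∷ x) y (_ ∷ ps) = ¬MarkerFree-++-∷ x y ps

  StartsWithMarker : Word → Set
  StartsWithMarker [] = ⊤
  StartsWithMarker (a ∷ _) = a ≡ c

  StartsWithMarker-φ-++ : ∀ u z → StartsWithMarker (φ u ++ c ∷ z)
  StartsWithMarker-φ-++ [] z = refl
  StartsWithMarker-φ-++ (a ∷ u) z = refl

  StartsWithMarker-φ : ∀ u → StartsWithMarker (φ u)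
  StartsWithMarker-φ [] = tt
  StartsWithMarker-φ (a ∷ u) = refl

  markerFree-prefix-unique : ∀ x x' r r' → MarkerFree x → MarkerFree x' →
    StartsWithMarker r → StartsWithMarker r' → x ++ r ≡ x' ++ r' → x ≡ x'
  markerFree-prefix-unique [] [] r r' _ _ _ _ _ = refl
  markerFree-prefix-unique [] (y ∷ x') (r0 ∷ r) r' _ (py ∷ _) hr _ e =
      ⊥-elim (py (trans (sym (∷-injectiveˡ e)) hr))
  markerFree-prefix-unique [] (y ∷ x') [] r' _ _ _ _ ()
  markerFree-prefix-unique (y ∷ x) [] r (r0 ∷ r') (py ∷ _) _ _ hr e = ⊥-elim (py (trans (∷-injectiveˡ e) hr))
  markerFree-prefix-unique (y ∷ x) [] r [] _ _ _ _ ()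
  markerFree-prefix-unique (y ∷ x) (y' ∷ x') r r' (_ ∷ px) (_ ∷ px') hr hr' e with ∷-injective e
  ... | refl , e2 = cong (y ∷_) (markerFree-prefix-unique x x' r r' px px' hr hr' e2)

  φ-injective : ∀ u v → φ u ≡ φ v → u ≡ v
  φ-injective [] [] _ = refl
  φ-injective [] (a ∷ v) ()
  φ-injective (a ∷ u) [] ()
  φ-injective (a ∷ u) (b ∷ v) e
    with refl ← q-injective a b (markerFree-prefix-unique (q a) (q b) (φ u) (φ v) (q-markerFree a)
        (q-markerFree b)
                                   (StartsWithMarker-φ u) (StartsWithMarker-φ v) (∷-injectiveʳ e))
    = cong (a ∷_) (φ-injective u v (++-cancelˡ (q a) _ _ (∷-injectiveʳ e)))

  firstMarker : ∀ w → MarkerFree w ⊎ (Σ Word λ t → Σ Word λ z → (w ≡ t ++ c ∷ z) × MarkerFree t)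
  firstMarker [] = inj₁ []
  firstMarker (a ∷ w) with a ≟ c
  ... | yes refl = inj₂ ([] , w , refl , [])
  ... | no ne with firstMarker w
  ... | inj₁ cf = inj₁ (ne ∷ cf)
  ... | inj₂ (t , z , e , cft) = inj₂ (a ∷ t , z , cong (a ∷_) e , ne ∷ cft)

  lastMarker : ∀ w → MarkerFree w ⊎ (Σ Word λ y → Σ Word λ s → (w ≡ y ++ c ∷ s) × MarkerFree s)
  lastMarker [] = inj₁ []
  lastMarker (a ∷ w) with lastMarker w
  ... | inj₂ (y , s , e , cfs') = inj₂ (a ∷ y , s , cong (a ∷_) e , cfs')
  ... | inj₁ cf with a ≟ c
  ... | yes refl = inj₂ ([] , w , refl , cf)
  ... | no ne = inj₁ (ne ∷ cf)

  firstMarker-unique : ∀ t z t' z' → MarkerFree t → MarkerFree t' → t ++ c ∷ z ≡ t' ++ c ∷ z' → t ≡ t'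
  firstMarker-unique t z t' z' ct ct' e = markerFree-prefix-unique t t' (c ∷ z) (c ∷ z') ct ct' refl refl e

  rev-++-∷ : ∀ y s → rev (y ++ c ∷ s) ≡ rev s ++ c ∷ rev y
  rev-++-∷ y s = trans (rev-++ y (c ∷ s)) (++-assoc (rev s) [ c ] (rev y))

  lastMarker-unique : ∀ y s y' s' → MarkerFree s → MarkerFree s' → y ++ c ∷ s ≡ y' ++ c ∷ s' → s ≡ s'
  lastMarker-unique y s y' s' cs cs' e =
    trans (sym (rev-involutive s)) (trans (cong rev r) (rev-involutive s'))
    where
    r : rev s ≡ rev s'
    r = firstMarker-unique (rev s) (rev y) (rev s') (rev y') (MarkerFree-rev cs) (MarkerFree-rev cs')
          (trans (sym (rev-++-∷ y s)) (trans (cong rev e) (rev-++-∷ y' s')))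

  markerFree-Prefix : ∀ p s t z → MarkerFree p → p ++ s ≡ t ++ c ∷ z → Prefix p t
  markerFree-Prefix [] s t z _ _ = t , refl
  markerFree-Prefix (x ∷ p) s [] z (px ∷ _) e = ⊥-elim (px (∷-injectiveˡ e))
  markerFree-Prefix (x ∷ p) s (y ∷ t) z (_ ∷ ps) e with ∷-injective e
  ... | refl , e2 with markerFree-Prefix p s t z ps e2
  ... | r , e3 = r , cong (x ∷_) e3

  skip-markerFree : ∀ qq α r z → MarkerFree qq → α ++ c ∷ z ≡ qq ++ r →
    Σ Word λ α'' → (α ≡ qq ++ α'') × (α'' ++ c ∷ z ≡ r)
  skip-markerFree [] α r z _ e = α , refl , e
  skip-markerFree (y ∷ qq) [] r z (py ∷ _) e = ⊥-elim (py (sym (∷-injectiveˡ e)))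
  skip-markerFree (y ∷ qq) (x ∷ α) r z (_ ∷ ps) e with ∷-injective e
  ... | refl , e2 with skip-markerFree qq α r z ps e2
  ... | α'' , e3 , e4 = α'' , cong (x ∷_) e3 , e4

  Φ-cons : ∀ a u → Φ (a ∷ u) ≡ c ∷ (q a ++ Φ u)
  Φ-cons a u = cong (c ∷_) (++-assoc (q a) (φ u) [ c ])

  []≢++∷ : ∀ (α : Word) x z → [] ≢ α ++ x ∷ z
  []≢++∷ [] x z ()
  []≢++∷ (_ ∷ α) x z ()

  Φ-split : ∀ U α z → Φ U ≡ α ++ c ∷ z →
    Σ Word λ U1 → Σ Word λ U2 → (U ≡ U1 ++ U2) × (α ≡ φ U1) × (c ∷ z ≡ Φ U2)
  Φ-split U [] z e = [] , U , refl , refl , sym e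
  Φ-split [] (x ∷ α) z e = ⊥-elim ([]≢++∷ α c z (∷-injectiveʳ e))
  Φ-split (a ∷ U) (x ∷ α) z e with ∷-injective (trans (sym (Φ-cons a U)) e)
  ... | refl , e2 with skip-markerFree (q a) α (Φ U) z (q-markerFree a) (sym e2)
  ... | α'' , e3 , e4 with Φ-split U α'' z (sym e4)
  ... | U1 , U2 , e5 , e6 , e7 = a ∷ U1 , U2 , cong (a ∷_) e5 , cong (c ∷_) (trans e3 (cong (q a ++_) e6)) , e7

  split-markerFree-suffix : ∀ α t y w → MarkerFree t → α ++ t ≡ y ++ c ∷ w →
    Σ Word λ α' → (α ≡ y ++ c ∷ α') × (α' ++ t ≡ w)
  split-markerFree-suffix [] t y w ct e = ⊥-elim (¬MarkerFree-++-∷ y w (subst MarkerFree e ct))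
  split-markerFree-suffix (x ∷ α) t [] w ct e with ∷-injective e
  ... | refl , e2 = α , refl , e2
  split-markerFree-suffix (x ∷ α) t (y0 ∷ y) w ct e with ∷-injective e
  ... | refl , e2 with split-markerFree-suffix α t y w ct e2
  ... | α' , e3 , e4 = α' , cong (x ∷_) e3 , e4

  LeftFlank : Word → Letter → Word → Set
  LeftFlank U1 x t = Σ Word λ U0 → Σ Letter λ b → Σ Word λ z → (U1 ≡ U0 ++ [ b ]) × (q b ≡ z ++ x ∷ t)

  leftFlank-∷ : ∀ a U' α x t → MarkerFree (x ∷ t) → α ++ x ∷ t ≡ φ (a ∷ U') → LeftFlank (a ∷ U') x t
  leftFlank-∷ a [] [] x t (px ∷ _) e = ⊥-elim (px (∷-injectiveˡ e))
  leftFlank-∷ a [] (y ∷ α) x t ct e with ∷-injective e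
  ... | refl , e2 = [] , a , α , refl , trans (sym (++-identityʳ (q a))) (sym e2)
  leftFlank-∷ a (a' ∷ U') α x t ct e with split-markerFree-suffix α (x ∷ t) (c ∷ q a) (q a' ++ φ U') ct e
  ... | α' , e3 , e4 with leftFlank-∷ a' U' (c ∷ α') x t ct (cong (c ∷_) e4)
  ... | U0 , b , z , e5 , e6 = a ∷ U0 , b , z , cong (a ∷_) e5 , e6

  leftFlank : ∀ U1 α x t → MarkerFree (x ∷ t) → α ++ x ∷ t ≡ φ U1 → LeftFlank U1 x t
  leftFlank [] [] x t ct ()
  leftFlank [] (_ ∷ α) x t ct ()
  leftFlank (a ∷ U') α x t ct e = leftFlank-∷ a U' α x t ct e

  Φ-tail : Word → Word
  Φ-tail [] = []
  Φ-tail (a ∷ u) = q a ++ Φ u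

  Φ-head : ∀ u → Φ u ≡ c ∷ Φ-tail u
  Φ-head [] = refl
  Φ-head (a ∷ u) = Φ-cons a u

  rightFlank : ∀ R t2 β → MarkerFree t2 → c ∷ t2 ++ β ≡ Φ R →
    ((t2 ≡ []) × (R ≡ [])) ⊎ (Σ Letter λ b → Σ Word λ R' → (R ≡ b ∷ R') × Prefix t2 (q b))
  rightFlank [] [] β _ e = inj₁ (refl , refl)
  rightFlank [] (x ∷ t2) β _ ()
  rightFlank (b ∷ R') t2 β ct e = inj₂ (b , R' , refl ,
    markerFree-Prefix t2 β (q b) (Φ-tail R') ct
        (trans (∷-injectiveʳ (trans e (Φ-cons b R'))) (cong (q b ++_) (Φ-head R'))))

  rev-Φ : ∀ N → rev (Φ N) ≡ Φ (rev N)
  rev-Φ [] = refl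
  rev-Φ (a ∷ N) = begin
      rev ((q a ++ φ N) ++ [ c ]) ++ [ c ]
    ≡⟨ cong (λ r → rev r ++ [ c ]) (++-assoc (q a) (φ N) [ c ]) ⟩
      rev (q a ++ (φ N ++ [ c ])) ++ [ c ]
    ≡⟨ cong (_++ [ c ]) (rev-++ (q a) (φ N ++ [ c ])) ⟩
      (rev (φ N ++ [ c ]) ++ rev (q a)) ++ [ c ]
    ≡⟨ cong₂ (λ r s → (r ++ s) ++ [ c ]) (rev-Φ N) (q-palindrome a) ⟩
      ((φ (rev N) ++ [ c ]) ++ q a) ++ [ c ]
    ≡⟨ solve 3 (λ X C Q → ((X ⊕ C) ⊕ Q) ⊕ C ⊜ (X ⊕ (C ⊕ Q)) ⊕ C) refl (φ (rev N)) [ c ] (q a) ⟩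
      (φ (rev N) ++ (c ∷ q a)) ++ [ c ]
    ≡⟨ cong (λ r → (φ (rev N) ++ (c ∷ r)) ++ [ c ]) (sym (++-identityʳ (q a))) ⟩
      (φ (rev N) ++ φ [ a ]) ++ [ c ]
    ≡⟨ cong (_++ [ c ]) (sym (φ-++ (rev N) [ a ])) ⟩
      φ (rev N ++ [ a ]) ++ [ c ]
    ∎
    where
    open ≡-Reasoning

  rev-framed : ∀ t N t2 → rev (t ++ φ N ++ c ∷ t2) ≡ rev t2 ++ φ (rev N) ++ c ∷ rev t
  rev-framed t N t2 = begin
      rev (t ++ φ N ++ c ∷ t2)
    ≡⟨ cong (λ r → rev (t ++ r)) (solve 3 (λ X C T → X ⊕ (C ⊕ T) ⊜ (X ⊕ C) ⊕ T) refl (φ N) [ c ] t2) ⟩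
      rev (t ++ (φ N ++ [ c ]) ++ t2)
    ≡⟨ rev-++ t _ ⟩
      rev ((φ N ++ [ c ]) ++ t2) ++ rev t
    ≡⟨ cong (_++ rev t) (rev-++ (φ N ++ [ c ]) t2) ⟩
      (rev t2 ++ rev (φ N ++ [ c ])) ++ rev t
    ≡⟨ cong (λ r → (rev t2 ++ r) ++ rev t) (rev-Φ N) ⟩
      (rev t2 ++ (φ (rev N) ++ [ c ])) ++ rev t
    ≡⟨ solve 4 (λ A X C B → (A ⊕ (X ⊕ C)) ⊕ B ⊜ A ⊕ (X ⊕ (C ⊕ B))) refl (rev t2) (φ (rev N)) [ c ] (rev t) ⟩
      rev t2 ++ φ (rev N) ++ c ∷ rev t
    ∎
    where open ≡-Reasoning

  Palindrome-framed⁻¹ : ∀ t v t2 → MarkerFree t → MarkerFree t2 →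
    Palindrome (t ++ φ v ++ c ∷ t2) → (t2 ≡ rev t) × Palindrome v
  Palindrome-framed⁻¹ t v t2 ct ct2 pp = e2 , φ-injective (rev v) v e4
    where
    e0 : rev t2 ++ φ (rev v) ++ c ∷ rev t ≡ t ++ φ v ++ c ∷ t2
    e0 = trans (sym (rev-framed t v t2)) pp
    e1 : rev t2 ≡ t
    e1 = markerFree-prefix-unique (rev t2) t (φ (rev v) ++ c ∷ rev t) (φ v ++ c ∷ t2) (MarkerFree-rev ct2) ct
           (StartsWithMarker-φ-++ (rev v) (rev t)) (StartsWithMarker-φ-++ v t2) e0
    e2 : t2 ≡ rev t
    e2 = trans (sym (rev-involutive t2)) (cong rev e1)
    e3 : φ (rev v) ++ c ∷ rev t ≡ φ v ++ c ∷ t2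
    e3 = ++-cancelˡ t _ _ (trans (cong (_++ _) (sym e1)) e0)
    e4 : φ (rev v) ≡ φ v
    e4 = ++-cancelʳ (c ∷ rev t) (φ (rev v)) (φ v) (trans e3 (cong (λ r → φ v ++ c ∷ r) e2))

  Palindrome-framed : ∀ t N → Palindrome N → Palindrome (t ++ φ N ++ c ∷ rev t)
  Palindrome-framed t N pN =
    trans (rev-framed t N (rev t)) (cong₂ (λ a b → a ++ φ b ++ c ∷ rev t) (rev-involutive t) pN)

  φ-Prefix-cancel : ∀ v N z z' → MarkerFree z' → φ v ++ c ∷ z ≡ φ N ++ c ∷ z' → Prefix v N
  φ-Prefix-cancel [] N z z' _ _ = N , refl
  φ-Prefix-cancel (a ∷ v) [] z z' cz' e = ⊥-elim (¬MarkerFree-++-∷ (q a ++ φ v) z (subst MarkerFree e2 cz'))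
    where
    e2 : z' ≡ (q a ++ φ v) ++ c ∷ z
    e2 = sym (∷-injectiveʳ e)
  φ-Prefix-cancel (a ∷ v) (b ∷ N) z z' cz' e =
    let s , es = φ-Prefix-cancel v N z z' cz' (++-cancelˡ (q a) _ _ (trans blocks (cong (λ x → q x ++ φ N ++ c ∷ z') (sym a≡b))))
    in s , cong₂ _∷_ (sym a≡b) es
    where
    blocks : q a ++ φ v ++ c ∷ z ≡ q b ++ φ N ++ c ∷ z'
    blocks = trans (sym (++-assoc (q a) (φ v) (c ∷ z))) (trans (∷-injectiveʳ e) (++-assoc (q b) (φ N) (c ∷ z')))
    a≡b : a ≡ b
    a≡b = q-injective a b (markerFree-prefix-unique (q a) (q b) (φ v ++ c ∷ z) (φ N ++ c ∷ z') (q-markerFree a)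
            (q-markerFree b) (StartsWithMarker-φ-++ v z) (StartsWithMarker-φ-++ N z') blocks)

  Prefix-rev⇒Suffix : ∀ v N → Prefix (rev v) (rev N) → Σ Word λ a → N ≡ a ++ v
  Prefix-rev⇒Suffix v N (s , e) = rev s ,
    trans (sym (rev-involutive N)) (trans (cong rev e)
        (trans (rev-++ (rev v) s) (cong (rev s ++_) (rev-involutive v))))

  φ-[] : ∀ a → φ a ≡ [] → a ≡ []
  φ-[] [] _ = refl
  φ-[] (x ∷ a) ()

  Φ-tail-[] : ∀ b → Φ-tail b ≡ [] → b ≡ []
  Φ-tail-[] [] _ = refl
  Φ-tail-[] (x ∷ b) e = ⊥-elim ([]≢++∷ (q x ++ φ b) c [] (sym (trans (++-assoc (q x) (φ b) [ c ]) e)))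

  CompleteReturn-Φ⁻¹ : ∀ v N → CompleteReturn (Φ v) (Φ N) → CompleteReturn v N
  CompleteReturn-Φ⁻¹ v N ((s , es) , (a , ea) , int) = pre , suf , int'
    where
    pre : Prefix v N
    pre = φ-Prefix-cancel v N s [] [] (sym (trans es (++-assoc (φ v) [ c ] s)))
    suf : Σ Word λ a → N ≡ a ++ v
    suf = Prefix-rev⇒Suffix v N (φ-Prefix-cancel (rev v) (rev N) (rev a) [] []
            (sym (trans (sym (rev-Φ N)) (trans (cong rev ea)
               (trans (rev-++ a (φ v ++ [ c ])) (trans (cong (_++ rev a) (rev-Φ v))
                   (++-assoc (φ (rev v)) [ c ] (rev a))))))))
    int' : ∀ a b → N ≡ a ++ v ++ b → a ≡ [] ⊎ b ≡ []
    int' a b e with int (φ a) (Φ-tail b) e2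
      where
      e2 : φ N ++ [ c ] ≡ φ a ++ (φ v ++ [ c ]) ++ Φ-tail b
      e2 = begin
          φ N ++ [ c ]
        ≡⟨ cong (λ r → φ r ++ [ c ]) e ⟩
          φ (a ++ v ++ b) ++ [ c ]
        ≡⟨ cong (_++ [ c ]) (trans (φ-++ a (v ++ b)) (cong (φ a ++_) (φ-++ v b))) ⟩
          (φ a ++ φ v ++ φ b) ++ [ c ]
        ≡⟨ solve 4 (λ A V B C → (A ⊕ V ⊕ B) ⊕ C ⊜ A ⊕ V ⊕ (B ⊕ C)) refl (φ a) (φ v) (φ b) [ c ] ⟩
          φ a ++ φ v ++ Φ b
        ≡⟨ cong (λ r → φ a ++ φ v ++ r) (Φ-head b) ⟩
          φ a ++ φ v ++ c ∷ Φ-tail b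
        ≡⟨ solve 4 (λ A V C B → A ⊕ V ⊕ (C ⊕ B) ⊜ A ⊕ (V ⊕ C) ⊕ B) refl (φ a) (φ v) [ c ] (Φ-tail b) ⟩
          φ a ++ (φ v ++ [ c ]) ++ Φ-tail b
        ∎
        where open ≡-Reasoning
    ... | inj₁ x = inj₁ (φ-[] a x)
    ... | inj₂ y = inj₂ (Φ-tail-[] b y)

  -- A factor w of Φ U containing the marker reads t φ(N) c t2, where t is a suffix of the block of
  -- the letter L just before N and t2 a prefix of the block of the letter R just after it.
  LeftBorder : Word → Word → Set
  LeftBorder t L = ((t ≡ []) × (L ≡ [])) ⊎ (Σ Letter λ b → (L ≡ [ b ]) × (Σ Word λ z → q b ≡ z ++ t))

  RightBorder : Word → Word → Set
  RightBorder t2 R = ((t2 ≡ []) × (R ≡ [])) ⊎ (Σ Letter λ b → (R ≡ [ b ]) × Prefix t2 (q b))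

  Parse : Word → Word → Set
  Parse U w = Σ Word λ t → Σ Word λ N → Σ Word λ t2 → Σ Word λ L → Σ Word λ R →
    (w ≡ t ++ φ N ++ c ∷ t2) × MarkerFree t × MarkerFree t2 ×
    Factor (L ++ N ++ R) U × LeftBorder t L × RightBorder t2 R

  leftBorder : ∀ U1 α t → MarkerFree t → α ++ t ≡ φ U1 → Σ Word λ L → Σ Word λ U0 → (U1 ≡ U0 ++ L) × LeftBorder t L
  leftBorder U1 α [] _ _ = [] , U1 , sym (++-identityʳ U1) , inj₁ (refl , refl)
  leftBorder U1 α (x ∷ t') ct' eα' with leftFlank U1 α x t' ct' eα'
  ... | U0 , b , z0 , e5 , e6 = [ b ] , U0 , e5 , inj₂ (b , refl , z0 , e6)

  parse : ∀ U w → Factor w (Φ U) → ¬ MarkerFree w → Parse U w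
  parse U w (α , β , ef) ncf with firstMarker w
  ... | inj₁ cf = ⊥-elim (ncf cf)
  ... | inj₂ (t , z , ew , ct) with lastMarker (c ∷ z)
  ... | inj₁ (p ∷ _) = ⊥-elim (p refl)
  ... | inj₂ (y , t2 , ez , ct2) with Φ-split U (α ++ t) (z ++ β) e1
    where
    e1 : Φ U ≡ (α ++ t) ++ c ∷ (z ++ β)
    e1 = trans ef (trans (cong (λ r → α ++ r ++ β) ew)
           (solve 5 (λ A T C Z B → A ⊕ (T ⊕ (C ⊕ Z)) ⊕ B ⊜ (A ⊕ T) ⊕ (C ⊕ (Z ⊕ B))) refl α t [ c ] z β))
  ... | U1 , U2 , eU , eα , eΦ2 with Φ-split U2 y (t2 ++ β) e2
    where
    e2 : Φ U2 ≡ y ++ c ∷ (t2 ++ β)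
    e2 = trans (sym eΦ2) (trans (cong (_++ β) ez) (++-assoc y (c ∷ t2) β))
  ... | N , R0 , eU2 , ey , eR0 = t , N , t2 , L , R , ew' , ct , ct2 , fac , lok , rok
    where
    ew' : w ≡ t ++ φ N ++ c ∷ t2
    ew' = trans ew (cong (t ++_) (trans ez (cong (_++ c ∷ t2) ey)))
    RR : Σ Word λ R → Σ Word λ R' → (R0 ≡ R ++ R') × RightBorder t2 R
    RR with rightFlank R0 t2 β ct2 eR0
    ... | inj₁ (e1 , e2) = [] , [] , e2 , inj₁ (e1 , refl)
    ... | inj₂ (b , R' , e1 , pr) = [ b ] , R' , e1 , inj₂ (b , refl , pr)
    R = proj₁ RR
    LL : Σ Word λ L → Σ Word λ U0 → (U1 ≡ U0 ++ L) × LeftBorder t L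
    LL = leftBorder U1 α t ct eα
    L = proj₁ LL
    lok = proj₂ (proj₂ (proj₂ LL))
    rok = proj₂ (proj₂ (proj₂ RR))
    fac : Factor (L ++ N ++ R) U
    fac = proj₁ (proj₂ LL) , proj₁ (proj₂ RR) ,
      (begin
         U
       ≡⟨ eU ⟩
         U1 ++ U2
       ≡⟨ cong₂ _++_ (proj₁ (proj₂ (proj₂ LL))) (trans eU2 (cong (N ++_) (proj₁ (proj₂ (proj₂ RR))))) ⟩
         (proj₁ (proj₂ LL) ++ L) ++ (N ++ (R ++ proj₁ (proj₂ RR)))
       ≡⟨ solve 5 (λ U0 L N R R' → (U0 ⊕ L) ⊕ (N ⊕ (R ⊕ R')) ⊜ U0 ⊕ (L ⊕ N ⊕ R) ⊕ R') refl
           (proj₁ (proj₂ LL)) L N R (proj₁ (proj₂ RR)) ⟩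
         proj₁ (proj₂ LL) ++ (L ++ N ++ R) ++ proj₁ (proj₂ RR)
       ∎)
      where open ≡-Reasoning

  -- W is a complete return to the set of words e v e' with e and e' in B.
  BorderedReturn : (Letter → Set) → Word → Word → Set
  BorderedReturn B v W = (Σ Letter λ e → Σ Letter λ e' → Σ Word λ d → B e × B e' × (W ≡ e ∷ v ++ e' ∷ d))
             × (Σ Word λ a → Σ Letter λ e → Σ Letter λ e' → B e × B e' × (W ≡ a ++ e ∷ v ++ [ e' ]))
             × (∀ a d e e' → B e → B e' → W ≡ a ++ e ∷ v ++ e' ∷ d → a ≡ [] ⊎ d ≡ [])

  EndsBlock : Word → Letter → Set
  EndsBlock t b = Σ Word λ z → q b ≡ z ++ t

  EndsBlock⇒Prefix-rev : ∀ t b → EndsBlock t b → Prefix (rev t) (q b)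
  EndsBlock⇒Prefix-rev t b (z , e) = rev z , trans (sym (q-palindrome b)) (trans (cong rev e) (rev-++ z t))

  Prefix-rev⇒EndsBlock : ∀ t b → Prefix (rev t) (q b) → EndsBlock t b
  Prefix-rev⇒EndsBlock t b (s , e) = rev s , trans (sym (q-palindrome b))
      (trans (cong rev e) (trans (rev-++ (rev t) s) (cong (rev s ++_) (rev-involutive t))))

  φ-++-marker : ∀ u z → Σ Word λ z' → φ u ++ c ∷ z ≡ c ∷ z'
  φ-++-marker [] z = z , refl
  φ-++-marker (a ∷ u) z = (q a ++ φ u) ++ c ∷ z , refl

  CompleteReturn-markerFree-ends : ∀ p t N t2 → MarkerFree p → CompleteReturn p (t ++ φ N ++ c ∷ t2) →
    Prefix p t × (Σ Word λ a → t2 ≡ a ++ p)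
  CompleteReturn-markerFree-ends p t N t2 cp ((s , es) , (a , ea) , _) =
    markerFree-Prefix p s t (proj₁ (φ-++-marker N t2)) cp
        (trans (sym es) (cong (t ++_) (proj₂ (φ-++-marker N t2)))) ,
    Prefix-rev⇒Suffix p t2 (markerFree-Prefix (rev p) (rev a) (rev t2) (proj₁ (φ-++-marker (rev N) (rev t)))
        (MarkerFree-rev cp)
      (trans (sym (rev-++ a p))
        (trans (cong rev (sym ea)) (trans (rev-framed t N t2)
            (cong (rev t2 ++_) (proj₂ (φ-++-marker (rev N) (rev t))))))))

  markerFree-Factor-block : ∀ qq α r z x β → MarkerFree qq → MarkerFree (x ∷ z) → qq ++ c ∷ r ≡ α ++ (x ∷ z) ++ β →
    (Σ Word λ α'' → (α ≡ qq ++ c ∷ α'') × (α'' ++ (x ∷ z) ++ β ≡ r)) ⊎ Factor (x ∷ z) qq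
  markerFree-Factor-block [] [] r z x β _ (px ∷ _) e = ⊥-elim (px (sym (∷-injectiveˡ e)))
  markerFree-Factor-block [] (y ∷ α) r z x β _ _ e with ∷-injective e
  ... | refl , e2 = inj₁ (α , refl , sym e2)
  markerFree-Factor-block (y ∷ qq) [] r z x β cq cz e = inj₂ ([] , proj₁ pr , proj₂ pr)
    where
    pr : Prefix (x ∷ z) (y ∷ qq)
    pr = markerFree-Prefix (x ∷ z) β (y ∷ qq) r cz (sym e)
  markerFree-Factor-block (y ∷ qq) (y' ∷ α) r z x β (_ ∷ cq) cz e with ∷-injective e
  ... | refl , e2 with markerFree-Factor-block qq α r z x β cq cz e2
  ... | inj₁ (α'' , e3 , e4) = inj₁ (α'' , cong (y ∷_) e3 , e4)
  ... | inj₂ (a , b , e3) = inj₂ (y ∷ a , b , cong (y ∷_) e3)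

  markerFree-Factor-Φ : ∀ U z → Factor z (Φ U) → MarkerFree z → (z ≡ []) ⊎ (Σ Letter λ B → Factor z (q B))
  markerFree-Factor-Φ U [] _ _ = inj₁ refl
  markerFree-Factor-Φ [] (x ∷ z) ([] , β , e) (px ∷ _) = ⊥-elim (px (sym (∷-injectiveˡ e)))
  markerFree-Factor-Φ [] (x ∷ z) (y ∷ α , β , e) _ = ⊥-elim ([]≢++∷ α x (z ++ β) (∷-injectiveʳ e))
  markerFree-Factor-Φ (a ∷ U) (x ∷ z) ([] , β , e) (px ∷ _) = ⊥-elim (px (sym (∷-injectiveˡ e)))
  markerFree-Factor-Φ (a ∷ U) (x ∷ z) (y ∷ α , β , e) cz with ∷-injective e
  ... | refl , e2 with markerFree-Factor-block (q a) α (Φ-tail U) z x β (q-markerFree a) cz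
      (trans (cong (q a ++_) (sym (Φ-head U))) (trans (sym (++-assoc (q a) (φ U) [ c ])) e2))
  ... | inj₂ f = inj₂ (a , f)
  ... | inj₁ (α'' , e3 , e4) = markerFree-Factor-Φ U (x ∷ z)
      (c ∷ α'' , β , trans (Φ-head U) (cong (c ∷_) (sym e4))) cz

  framed-Prefix⇒next : ∀ t v N b' s → MarkerFree t → EndsBlock t b' →
    t ++ φ N ++ c ∷ rev t ≡ (t ++ φ v ++ c ∷ rev t) ++ s → Σ Letter λ e' → Σ Word λ d →
    EndsBlock t e' × (N ++ [ b' ] ≡ v ++ e' ∷ d)
  framed-Prefix⇒next t v N b' s ct bb' e with φ-Prefix-cancel v N (rev t ++ s) (rev t) (MarkerFree-rev ct)
      (sym e1)
    where
    e1 : φ N ++ c ∷ rev t ≡ φ v ++ c ∷ (rev t ++ s)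
    e1 = ++-cancelˡ t _ _ (trans e (solve 5 (λ T V C RT S → (T ⊕ V ⊕ C ⊕ RT) ⊕ S ⊜ T ⊕ V ⊕ C ⊕ (RT ⊕ S)) refl t
        (φ v) [ c ] (rev t) s))
  ... | [] , eN = b' , [] , bb' , cong (_++ [ b' ]) (trans eN (++-identityʳ v))
  ... | x ∷ N3 , eN = x , N3 ++ [ b' ] , Prefix-rev⇒EndsBlock t x
      (markerFree-Prefix (rev t) s (q x) (proj₁ (φ-++-marker N3 (rev t))) (MarkerFree-rev ct) (sym e3)) ,
        trans (cong (_++ [ b' ]) eN) (++-assoc v (x ∷ N3) [ b' ])
    where
    e1 : φ N ++ c ∷ rev t ≡ φ v ++ c ∷ (rev t ++ s)
    e1 = ++-cancelˡ t _ _ (trans e (solve 5 (λ T V C RT S → (T ⊕ V ⊕ C ⊕ RT) ⊕ S ⊜ T ⊕ V ⊕ C ⊕ (RT ⊕ S)) refl t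
        (φ v) [ c ] (rev t) s))
    e2 : φ (x ∷ N3) ++ c ∷ rev t ≡ c ∷ (rev t ++ s)
    e2 = ++-cancelˡ (φ v) _ _ (trans (sym (++-assoc (φ v) (φ (x ∷ N3)) (c ∷ rev t)))
           (trans (cong (_++ c ∷ rev t) (sym (φ-++ v (x ∷ N3))))
               (trans (cong (λ r → φ r ++ c ∷ rev t) (sym eN)) e1)))
    e3 : q x ++ c ∷ proj₁ (φ-++-marker N3 (rev t)) ≡ rev t ++ s
    e3 = trans (cong (q x ++_) (sym (proj₂ (φ-++-marker N3 (rev t)))))
        (trans (sym (++-assoc (q x) (φ N3) (c ∷ rev t))) (∷-injectiveʳ e2))

  rev-framed-sym : ∀ t N → rev (t ++ φ N ++ c ∷ rev t) ≡ t ++ φ (rev N) ++ c ∷ rev t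
  rev-framed-sym t N = trans (rev-framed t N (rev t))
      (cong (λ r → r ++ φ (rev N) ++ c ∷ rev t) (rev-involutive t))

  φ-occurrence : ∀ a' e v e' d' →
    φ (a' ++ (e ∷ v ++ [ e' ]) ++ d') ≡ φ a' ++ (c ∷ (q e ++ φ v ++ c ∷ q e')) ++ φ d'
  φ-occurrence a' e v e' d' = trans (φ-++ a' _) (cong (φ a' ++_) (trans (φ-++ (e ∷ v ++ [ e' ]) d')
    (cong (λ r → (c ∷ (q e ++ r)) ++ φ d') (trans (φ-++ v [ e' ])
        (cong (λ r → φ v ++ c ∷ r) (++-identityʳ (q e')))))))

  BorderedReturn-framed⁻¹ : ∀ t v N b b' → t ≢ [] → MarkerFree t → EndsBlock t b → EndsBlock t b' →
    CompleteReturn (t ++ φ v ++ c ∷ rev t) (t ++ φ N ++ c ∷ rev t) → BorderedReturn (EndsBlock t) v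
        (b ∷ N ++ [ b' ])
  BorderedReturn-framed⁻¹ t v N b b' tne ct bb bb' ((s , es) , (a , ea) , int) = st , en , it
    where
    st : Σ Letter λ e → Σ Letter λ e' → Σ Word λ d →
      EndsBlock t e × EndsBlock t e' × (b ∷ N ++ [ b' ] ≡ e ∷ v ++ e' ∷ d)
    st with framed-Prefix⇒next t v N b' s ct bb' es
    ... | e' , d , be' , eq = b , e' , d , bb , be' , cong (b ∷_) eq
    e3 : t ++ φ (rev N) ++ c ∷ rev t ≡ (t ++ φ (rev v) ++ c ∷ rev t) ++ rev a
    e3 = trans (sym (rev-framed-sym t N)) (trans (cong rev ea)
        (trans (rev-++ a _) (cong (_++ rev a) (rev-framed-sym t v))))
    en : Σ Word λ a → Σ Letter λ e → Σ Letter λ e' →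
      EndsBlock t e × EndsBlock t e' × (b ∷ N ++ [ b' ] ≡ a ++ e ∷ v ++ [ e' ])
    en with framed-Prefix⇒next t (rev v) (rev N) b (rev a) ct bb e3
    ... | e , d , be , eq = rev d , e , b' , be , bb' , fin
      where
      e4 : b ∷ N ≡ (rev d ++ [ e ]) ++ v
      e4 = trans (cong (b ∷_) (sym (rev-involutive N)))
          (trans (sym (rev-++ (rev N) [ b ])) (trans (cong rev eq)
          (trans (rev-++ (rev v) (e ∷ d)) (cong ((rev d ++ [ e ]) ++_) (rev-involutive v)))))
      fin : b ∷ N ++ [ b' ] ≡ rev d ++ e ∷ v ++ [ b' ]
      fin = trans (cong (_++ [ b' ]) e4) (solve 4 (λ D E V B → ((D ⊕ E) ⊕ V) ⊕ B ⊜ D ⊕ (E ⊕ (V ⊕ B))) refl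
          (rev d) [ e ] v [ b' ])
    it : ∀ a d e e' → EndsBlock t e → EndsBlock t e' → b ∷ N ++ [ b' ] ≡ a ++ e ∷ v ++ e' ∷ d → a ≡ [] ⊎ d ≡ []
    it [] d e e' _ _ _ = inj₁ refl
    it (x ∷ a0) [] e e' _ _ _ = inj₂ refl
    it (x ∷ a0) (y ∷ d0) e e' (z0 , ez0) be' eW with strip-ends b N b' (x ∷ a0) (e ∷ v ++ [ e' ]) (y ∷ d0)
        (trans eW (solve 5 (λ A E V E' D → A ⊕ (E ⊕ (V ⊕ (E' ⊕ D))) ⊜ A ⊕ ((E ⊕ (V ⊕ E')) ⊕ D)) refl
            (x ∷ a0) [ e ] v [ e' ] (y ∷ d0))) (λ ()) (λ ())
    ... | a' , d' , _ , _ , eN with EndsBlock⇒Prefix-rev t e' be'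
    ... | z1 , ez1 with int (t ++ φ a' ++ c ∷ z0) (z1 ++ φ d' ++ c ∷ rev t) eqw
      where
      eqw : t ++ φ N ++ c ∷ rev t ≡ (t ++ φ a' ++ c ∷ z0) ++ (t ++ φ v ++ c ∷ rev t) ++ (z1 ++ φ d' ++ c ∷ rev t)
      eqw = begin
          t ++ φ N ++ c ∷ rev t
        ≡⟨ cong (λ r → t ++ φ r ++ c ∷ rev t) eN ⟩
          t ++ φ (a' ++ (e ∷ v ++ [ e' ]) ++ d') ++ c ∷ rev t
        ≡⟨ cong (λ r → t ++ r ++ c ∷ rev t) (φ-occurrence a' e v e' d') ⟩
          t ++ (φ a' ++ (c ∷ (q e ++ φ v ++ c ∷ q e')) ++ φ d') ++ c ∷ rev t
        ≡⟨ cong₂ (λ r1 r2 → t ++ (φ a' ++ (c ∷ (r1 ++ φ v ++ c ∷ r2)) ++ φ d') ++ c ∷ rev t) ez0 ez1 ⟩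
          t ++ (φ a' ++ (c ∷ ((z0 ++ t) ++ φ v ++ c ∷ (rev t ++ z1))) ++ φ d') ++ c ∷ rev t
        ≡⟨ solve 8 (λ T A C Z0 V RT Z1 D →
              T ⊕ (A ⊕ (C ⊕ ((Z0 ⊕ T) ⊕ V ⊕ C ⊕ (RT ⊕ Z1))) ⊕ D) ⊕ (C ⊕ RT)
              ⊜ (T ⊕ A ⊕ C ⊕ Z0) ⊕ (T ⊕ V ⊕ C ⊕ RT) ⊕ (Z1 ⊕ D ⊕ C ⊕ RT))
            refl t (φ a') [ c ] z0 (φ v) (rev t) z1 (φ d') ⟩
          (t ++ φ a' ++ c ∷ z0) ++ (t ++ φ v ++ c ∷ rev t) ++ (z1 ++ φ d' ++ c ∷ rev t)
        ∎
        where open ≡-Reasoning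
    ... | inj₁ h = ⊥-elim (tne (++-conicalˡ t _ h))
    ... | inj₂ h = ⊥-elim ([]≢++∷ (z1 ++ φ d') c (rev t) (sym (trans (++-assoc z1 (φ d') (c ∷ rev t)) h)))

  BorderedReturn⇒CompleteReturn : ∀ B β v W → (∀ x → B x → x ≡ β) → B β → BorderedReturn B v W →
    CompleteReturn (β ∷ v ++ [ β ]) W
  BorderedReturn⇒CompleteReturn B β v W det bβ
      ((e , e' , d , be , be' , es) , (a , f , f' , bf , bf' , ea) , int) = pre , suf , it
    where
    pre : Prefix (β ∷ v ++ [ β ]) W
    pre with det e be | det e' be'
    ... | refl | refl = d , trans es (cong (e ∷_)
        (solve 3 (λ V E D → V ⊕ (E ⊕ D) ⊜ (V ⊕ E) ⊕ D) refl v [ e ] d))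
    suf : Σ Word λ a → W ≡ a ++ β ∷ v ++ [ β ]
    suf with det f bf | det f' bf'
    ... | refl | refl = a , ea
    it : ∀ a d → W ≡ a ++ (β ∷ v ++ [ β ]) ++ d → a ≡ [] ⊎ d ≡ []
    it a d e = int a d β β bβ bβ (trans e (cong (a ++_)
        (cong (β ∷_) (solve 3 (λ V E D → (V ⊕ E) ⊕ D ⊜ V ⊕ (E ⊕ D)) refl v [ β ] d))))

  CompleteReturn-framed⁻¹ : ∀ t v N β → t ≢ [] → MarkerFree t → EndsBlock t β → (∀ x → EndsBlock t x → x ≡ β) →
    CompleteReturn (t ++ φ v ++ c ∷ rev t) (t ++ φ N ++ c ∷ rev t) → CompleteReturn (β ∷ v ++ [ β ])
        (β ∷ N ++ [ β ])
  CompleteReturn-framed⁻¹ t v N β t≢[] ct ends only ret =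
    BorderedReturn⇒CompleteReturn (EndsBlock t) β v _ only ends
        (BorderedReturn-framed⁻¹ t v N β β t≢[] ct ends ends ret)

  CompleteReturn-block⁻¹ : ∀ β N → q β ≢ [] → CompleteReturn (q β) (q β ++ φ N ++ c ∷ q β) →
    CompleteReturn [ β ] (β ∷ N ++ [ β ])
  CompleteReturn-block⁻¹ β N qne (_ , _ , int) = (N ++ [ β ] , refl) , (β ∷ N , refl) , it
    where
    it : ∀ a d → β ∷ N ++ [ β ] ≡ a ++ [ β ] ++ d → a ≡ [] ⊎ d ≡ []
    it [] d _ = inj₁ refl
    it (x ∷ a0) [] _ = inj₂ refl
    it (x ∷ a0) (y ∷ d0) eW with strip-ends β N β (x ∷ a0) [ β ] (y ∷ d0) eW (λ ()) (λ ())
    ... | a' , d' , _ , _ , eN with int (q β ++ φ a' ++ [ c ]) (φ d' ++ c ∷ q β) eqw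
      where
      eqw : q β ++ φ N ++ c ∷ q β ≡ (q β ++ φ a' ++ [ c ]) ++ q β ++ (φ d' ++ c ∷ q β)
      eqw = begin
          q β ++ φ N ++ c ∷ q β
        ≡⟨ cong (λ r → q β ++ φ r ++ c ∷ q β) eN ⟩
          q β ++ φ (a' ++ [ β ] ++ d') ++ c ∷ q β
        ≡⟨ cong (λ r → q β ++ r ++ c ∷ q β) (φ-++ a' (β ∷ d')) ⟩
          q β ++ (φ a' ++ c ∷ q β ++ φ d') ++ c ∷ q β
        ≡⟨ solve 4 (λ Q A C D → Q ⊕ (A ⊕ (C ⊕ Q) ⊕ D) ⊕ (C ⊕ Q) ⊜ (Q ⊕ A ⊕ C) ⊕ Q ⊕ (D ⊕ C ⊕ Q)) refl (q β)
            (φ a') [ c ] (φ d') ⟩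
          (q β ++ φ a' ++ [ c ]) ++ q β ++ (φ d' ++ c ∷ q β)
        ∎
        where open ≡-Reasoning
    ... | inj₁ h = ⊥-elim (qne (++-conicalˡ (q β) _ h))
    ... | inj₂ h = ⊥-elim ([]≢++∷ (φ d') c (q β) (sym h))

  -- A complete return w in Φ U to a palindrome p containing the marker is framed exactly like p.
  FramedReturn : Word → Word → Word → Set
  FramedReturn U p w = Σ Word λ t → Σ Word λ v → Σ Word λ N → Σ Word λ L → Σ Word λ R →
    MarkerFree t × Palindrome v × (p ≡ t ++ φ v ++ c ∷ rev t) × (w ≡ t ++ φ N ++ c ∷ rev t) ×
    Factor (L ++ N ++ R) U × LeftBorder t L × RightBorder (rev t) R

  parseReturn : ∀ U p w → Factor w (Φ U) → Palindrome p → ¬ MarkerFree p → CompleteReturn p w → FramedReturn U p w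
  parseReturn U p w fw pp ncp ((s , es) , (a , ea) , _)
    with parse U p (Factor-trans (Prefix⇒Factor (s , es)) fw) ncp | parse U w fw (λ cw → ncp (cfsub cw))
    where
    cfsub : MarkerFree w → MarkerFree p
    cfsub cw = ++⁻ˡ p (subst MarkerFree es cw)
  ... | tp , v , t2p , _ , _ , ep , ctp , ct2p , _ , _ , _ | t , N , t2 , L , R , ew , ct , ct2 , fac , lok , rok
    with Palindrome-framed⁻¹ tp v t2p ctp ct2p (subst Palindrome ep pp)
  ... | et2p , pv with firstMarker-unique t (proj₁ (φ-++-marker N t2)) tp
      (proj₁ (φ-++-marker v t2p) ++ s) ct ctp e1
    where
    e1 : t ++ c ∷ proj₁ (φ-++-marker N t2) ≡ tp ++ c ∷ (proj₁ (φ-++-marker v t2p) ++ s)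
    e1 = trans (cong (t ++_) (sym (proj₂ (φ-++-marker N t2))))
        (trans (sym ew) (trans es (trans (cong (_++ s) ep)
           (trans (++-assoc tp _ s) (cong (tp ++_) (cong (_++ s) (proj₂ (φ-++-marker v t2p))))))))
  ... | refl with lastMarker-unique (t ++ φ N) t2 ((a ++ t) ++ φ v) t2p ct2 ct2p e2
    where
    e2 : (t ++ φ N) ++ c ∷ t2 ≡ ((a ++ t) ++ φ v) ++ c ∷ t2p
    e2 = trans (++-assoc t (φ N) (c ∷ t2)) (trans (sym ew) (trans ea (trans (cong (a ++_) ep)
           (solve 5 (λ A T V C S → A ⊕ (T ⊕ (V ⊕ (C ⊕ S))) ⊜ ((A ⊕ T) ⊕ V) ⊕ (C ⊕ S)) refl a t
               (φ v) [ c ] t2p))))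
  ... | refl = t , v , N , L , R , ct , pv , trans ep (cong (λ r → t ++ φ v ++ c ∷ r) et2p) ,
               trans ew (cong (λ r → t ++ φ N ++ c ∷ r) et2p) , fac , lok ,
               subst (λ r → RightBorder r R) et2p rok

  module FramedBorders (B : Letter → Set) (B⇒≢c : ∀ x → B x → x ≢ c)
    (q-last : ∀ x → Σ Word λ z → Σ Letter λ e → (q x ≡ z ++ [ e ]) × B e)
    (q-first : ∀ x → Σ Letter λ e → Σ Word λ z → (q x ≡ e ∷ z) × B e) where

    BorderedReturn-Φ⁻¹ : ∀ v' b M b' → BorderedReturn B (Φ v') (b ∷ Φ M ++ [ b' ]) → CompleteReturn v' M
    BorderedReturn-Φ⁻¹ v' b M b' ((e , e' , d , be , be' , es) ,
        (a , f , f' , bf , bf' , ea) , int) = pre , suf , it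
      where
      pre : Prefix v' M
      bb' : B b'
      bb' = subst B (sym (proj₂ (∷ʳ-injective ((b ∷ φ M ++ [ c ])) (a ++ f ∷ φ v' ++ [ c ])
              (trans ea (solve 5 (λ A F V C F' → A ⊕ (F ⊕ ((V ⊕ C) ⊕ F')) ⊜
                  (A ⊕ (F ⊕ (V ⊕ C))) ⊕ F') refl a [ f ] (φ v') [ c ] [ f' ]))))) bf'
      pre = φ-Prefix-cancel v' M (e' ∷ d) [ b' ] (B⇒≢c b' bb' ∷ [])
              (sym (trans (sym (++-assoc (φ M) [ c ] [ b' ]))
                  (trans (∷-injectiveʳ es) (++-assoc (φ v') [ c ] (e' ∷ d)))))
      suf : Σ Word λ a → M ≡ a ++ v'
      suf with ∷ʳ-injective ((b ∷ φ M ++ [ c ])) (a ++ f ∷ φ v' ++ [ c ]) e5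
        where
        e5 : (b ∷ φ M ++ [ c ]) ++ [ b' ] ≡ (a ++ f ∷ φ v' ++ [ c ]) ++ [ f' ]
        e5 = trans ea (solve 5 (λ A F V C F' → A ⊕ (F ⊕ ((V ⊕ C) ⊕ F')) ⊜ (A ⊕ (F ⊕ (V ⊕ C))) ⊕ F') refl a [ f ]
            (φ v') [ c ] [ f' ])
      ... | e6 , _ = Prefix-rev⇒Suffix v' M (φ-Prefix-cancel (rev v') (rev M) (f ∷ rev a) [ b ]
          (B⇒≢c b bb ∷ []) e7)
        where
        bb : B b
        bb = subst B (sym (∷-injectiveˡ es)) be
        e7 : φ (rev v') ++ c ∷ f ∷ rev a ≡ φ (rev M) ++ c ∷ [ b ]
        e7 = begin
            φ (rev v') ++ c ∷ f ∷ rev a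
          ≡⟨ solve 4 (λ V C F A → V ⊕ (C ⊕ (F ⊕ A)) ⊜ (V ⊕ C) ⊕ (F ⊕ A)) refl (φ (rev v')) [ c ] [ f ] (rev a) ⟩
            (φ (rev v') ++ [ c ]) ++ f ∷ rev a
          ≡⟨ cong (_++ f ∷ rev a) (sym (rev-Φ v')) ⟩
            rev (φ v' ++ [ c ]) ++ f ∷ rev a
          ≡⟨ solve 3 (λ X F A → X ⊕ (F ⊕ A) ⊜ (X ⊕ F) ⊕ A) refl (rev (φ v' ++ [ c ])) [ f ] (rev a) ⟩
            (rev (φ v' ++ [ c ]) ++ [ f ]) ++ rev a
          ≡⟨ sym (rev-++ a (f ∷ φ v' ++ [ c ])) ⟩
            rev (a ++ f ∷ φ v' ++ [ c ])
          ≡⟨ cong rev (sym e6) ⟩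
            rev (φ M ++ [ c ]) ++ [ b ]
          ≡⟨ cong (_++ [ b ]) (rev-Φ M) ⟩
            (φ (rev M) ++ [ c ]) ++ [ b ]
          ≡⟨ ++-assoc (φ (rev M)) [ c ] [ b ] ⟩
            φ (rev M) ++ c ∷ [ b ]
          ∎
          where open ≡-Reasoning
      it : ∀ a d → M ≡ a ++ v' ++ d → a ≡ [] ⊎ d ≡ []
      it [] d _ = inj₁ refl
      it (x ∷ a0) [] _ = inj₂ refl
      it (x ∷ a0) (y ∷ d0) eM with unsnoc (x ∷ a0) (λ ())
      ... | a1 , xl , ea1 with q-last xl | q-first y
      ... | z , el , eql , bel | ef , z' , eqf , bef with int (b ∷ φ a1 ++ c ∷ z)
          (z' ++ φ d0 ++ c ∷ [ b' ]) el ef bel bef eqW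
        where
        eqW : b ∷ (φ M ++ [ c ]) ++ [ b' ] ≡ (b ∷ φ a1 ++ c ∷ z) ++ el ∷ (φ v' ++ [ c ]) ++ ef ∷ (z' ++ φ d0 ++ c ∷ [ b' ])
        eqW = cong (b ∷_) (begin
            (φ M ++ [ c ]) ++ [ b' ]
          ≡⟨ cong (λ r → (φ r ++ [ c ]) ++ [ b' ]) (trans eM (cong (_++ v' ++ y ∷ d0) ea1)) ⟩
            (φ ((a1 ++ [ xl ]) ++ v' ++ y ∷ d0) ++ [ c ]) ++ [ b' ]
          ≡⟨ cong (λ r → (r ++ [ c ]) ++ [ b' ]) (trans (φ-++ (a1 ++ [ xl ]) _)
              (cong₂ _++_ (φ-++ a1 [ xl ]) (φ-++ v' (y ∷ d0)))) ⟩
            (((φ a1 ++ c ∷ (q xl ++ [])) ++ (φ v' ++ c ∷ (q y ++ φ d0))) ++ [ c ]) ++ [ b' ]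
          ≡⟨ cong₂ (λ r1 r2 → (((φ a1 ++ c ∷ r1) ++ (φ v' ++ c ∷ (r2 ++ φ d0))) ++ [ c ]) ++ [ b' ])
              (trans (++-identityʳ (q xl)) eql) eqf ⟩
            (((φ a1 ++ c ∷ (z ++ [ el ])) ++ (φ v' ++ c ∷ (ef ∷ z' ++ φ d0))) ++ [ c ]) ++ [ b' ]
          ≡⟨ solve 9 (λ A C Z E V F Z' D B →
                (((A ⊕ (C ⊕ (Z ⊕ E))) ⊕ (V ⊕ (C ⊕ (F ⊕ (Z' ⊕ D))))) ⊕ C) ⊕ B
                ⊜ (A ⊕ C ⊕ Z) ⊕ E ⊕ (V ⊕ C) ⊕ F ⊕ (Z' ⊕ D ⊕ C ⊕ B))
              refl (φ a1) [ c ] z [ el ] (φ v') [ ef ] z' (φ d0) [ b' ] ⟩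
            (φ a1 ++ c ∷ z) ++ el ∷ (φ v' ++ [ c ]) ++ ef ∷ (z' ++ φ d0 ++ c ∷ [ b' ])
          ∎)
          where open ≡-Reasoning
      ... | inj₁ ()
      ... | inj₂ h = ⊥-elim ([]≢++∷ (z' ++ φ d0) c [ b' ] (sym (trans (++-assoc z' (φ d0) (c ∷ [ b' ])) h)))

  length-φ : ∀ w → length w ≤ length (φ w)
  length-φ [] = z≤n
  length-φ (a ∷ w) = s≤s (≤-trans (length-φ w)
      (≤-trans (m≤n+m (length (φ w)) (length (q a))) (≤-reflexive (sym (length-++ (q a))))))

module FactorsOfX where

  qᶠ : Letter → Word
  qᶠ l0 = l1 ∷ []
  qᶠ l1 = l2 ∷ l2 ∷ []
  qᶠ l2 = l2 ∷ []

  qᶠ-markerFree : ∀ a → All (_≢ l0) (qᶠ a)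
  qᶠ-markerFree l0 = (λ ()) ∷ []
  qᶠ-markerFree l1 = (λ ()) ∷ (λ ()) ∷ []
  qᶠ-markerFree l2 = (λ ()) ∷ []

  qᶠ-palindrome : ∀ a → Palindrome (qᶠ a)
  qᶠ-palindrome l0 = refl
  qᶠ-palindrome l1 = refl
  qᶠ-palindrome l2 = refl

  qᶠ-injective : ∀ a b → qᶠ a ≡ qᶠ b → a ≡ b
  qᶠ-injective l0 l0 _ = refl
  qᶠ-injective l1 l1 _ = refl
  qᶠ-injective l2 l2 _ = refl
  qᶠ-injective l0 l1 ()
  qᶠ-injective l0 l2 ()
  qᶠ-injective l1 l0 ()
  qᶠ-injective l1 l2 ()
  qᶠ-injective l2 l0 ()
  qᶠ-injective l2 l1 ()

  open Marker l0 qᶠ qᶠ-markerFree qᶠ-palindrome qᶠ-injective public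

  morph-f≡φ : ∀ w → morph f w ≡ φ w
  morph-f≡φ [] = refl
  morph-f≡φ (l0 ∷ w) = cong (λ r → l0 ∷ l1 ∷ r) (morph-f≡φ w)
  morph-f≡φ (l1 ∷ w) = cong (λ r → l0 ∷ l2 ∷ l2 ∷ r) (morph-f≡φ w)
  morph-f≡φ (l2 ∷ w) = cong (λ r → l0 ∷ l2 ∷ r) (morph-f≡φ w)

  X : ℕ → Word
  X k = iterate k (morph f) (l0 ∷ [])

  X-suc : ∀ k → X (suc k) ≡ φ (X k)
  X-suc k = morph-f≡φ (X k)

  X-Prefix-suc : ∀ k → Prefix (X k) (X (suc k))
  X-Prefix-suc zero = (l1 ∷ []) , refl
  X-Prefix-suc (suc k) with X-Prefix-suc k
  ... | s , e = φ s , trans (X-suc (suc k))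
      (trans (cong φ e) (trans (φ-++ (X k) s) (cong (_++ φ s) (sym (X-suc k)))))

  -- Φ (X k) = X (k + 1) 0 is a prefix of x.
  Lx : Word → Set
  Lx w = Σ ℕ λ k → Factor w (Φ (X k))

  Lx-factorClosed : FactorClosed Lx
  Lx-factorClosed u w fu (k , fw) = k , Factor-trans fu fw

  X-Factor-ΦX : ∀ k → Factor (X k) (Φ (X k))
  X-Factor-ΦX k with X-Prefix-suc k
  ... | s , e = [] , s ++ [ l0 ] , trans (cong (_++ [ l0 ]) (trans (sym (X-suc k)) e)) (++-assoc (X k) s [ l0 ])

  Factor-X⇒Lx : ∀ {u} k → Factor u (X k) → Lx u
  Factor-X⇒Lx k fu = k , Factor-trans fu (X-Factor-ΦX k)

  -- Chosen so that desubstituting a framed palindrome strictly decreases the weight.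
  weight : Letter → ℕ
  weight l0 = 1
  weight l1 = 2
  weight l2 = 2

  μ : Word → ℕ
  μ [] = 0
  μ (a ∷ w) = weight a + μ w

  μ-++ : ∀ u v → μ (u ++ v) ≡ μ u + μ v
  μ-++ [] v = refl
  μ-++ (a ∷ u) v = trans (cong (weight a +_) (μ-++ u v)) (sym (+-assoc (weight a) (μ u) (μ v)))

  μ-rev : ∀ u → μ (rev u) ≡ μ u
  μ-rev [] = refl
  μ-rev (a ∷ u) = trans (μ-++ (rev u) [ a ]) (trans (cong (_+ (weight a + 0)) (μ-rev u))
    (trans (cong (μ u +_) (+-comm (weight a) 0)) (+-comm (μ u) (weight a))))

  weight≤μ-block : ∀ a → weight a ≤ suc (μ (qᶠ a))
  weight≤μ-block l0 = s≤s z≤n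
  weight≤μ-block l1 = s≤s (s≤s z≤n)
  weight≤μ-block l2 = s≤s (s≤s z≤n)

  μ-φ : ∀ v → μ v ≤ μ (φ v)
  μ-φ [] = z≤n
  μ-φ (a ∷ v) = ≤-trans (+-mono-≤ (weight≤μ-block a) (μ-φ v)) (≤-reflexive (cong suc (sym (μ-++ (qᶠ a) (φ v)))))

  μ-framed : ∀ t v → μ (t ++ φ v ++ l0 ∷ rev t) ≡ μ t + (μ (φ v) + suc (μ t))
  μ-framed t v = trans (μ-++ t _) (cong (μ t +_)
      (trans (μ-++ (φ v) (l0 ∷ rev t)) (cong (λ r → μ (φ v) + suc r) (μ-rev t))))

  μ-framed-> : ∀ t v → μ v + (μ t + μ t) < μ (t ++ φ v ++ l0 ∷ rev t)
  μ-framed-> t v = begin-strict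
    μ v + (μ t + μ t)           ≤⟨ +-monoˡ-≤ (μ t + μ t) (μ-φ v) ⟩
    μ (φ v) + (μ t + μ t)       <⟨ n<1+n _ ⟩
    suc (μ (φ v) + (μ t + μ t)) ≡⟨ rearrange (μ t) (μ (φ v)) ⟨
    μ t + (μ (φ v) + suc (μ t)) ≡⟨ μ-framed t v ⟨
    μ (t ++ φ v ++ l0 ∷ rev t)  ∎
    where
    open ≤-Reasoning
    rearrange : ∀ m x → m + (x + suc m) ≡ suc (x + (m + m))
    rearrange = solve-∀

  μ-wrap : ∀ a v → μ (a ∷ v ++ [ a ]) ≡ μ v + (weight a + weight a)
  μ-wrap a v = trans (cong (weight a +_) (μ-++ v [ a ])) (rearrange (weight a) (μ v))
    where
    rearrange : ∀ w m → w + (m + (w + 0)) ≡ m + (w + w)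
    rearrange = solve-∀

  wrap<framed : ∀ a t v → weight a + weight a ≤ μ t + μ t → μ (a ∷ v ++ [ a ]) < μ (t ++ φ v ++ l0 ∷ rev t)
  wrap<framed a t v le = ≤-<-trans (≤-trans (≤-reflexive (μ-wrap a v)) (+-monoʳ-≤ (μ v) le)) (μ-framed-> t v)

  markerFree? : (w : Word) → Dec (MarkerFree w)
  markerFree? w = all? (λ a → ¬? (a ≟ l0)) w

  Ends2 : Letter → Set
  Ends2 = EndsBlock (l2 ∷ [])

  Ends2⇒≢0 : ∀ x → Ends2 x → x ≢ l0
  Ends2⇒≢0 l0 ([] , ()) refl
  Ends2⇒≢0 l0 (x ∷ [] , ()) refl
  Ends2⇒≢0 l0 (x ∷ y ∷ z , ()) refl

  Ends2-1 : Ends2 l1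
  Ends2-1 = (l2 ∷ []) , refl
  Ends2-2 : Ends2 l2
  Ends2-2 = [] , refl

  EndsBlock-1⇒0 : ∀ x → EndsBlock (l1 ∷ []) x → x ≡ l0
  EndsBlock-1⇒0 l0 _ = refl
  EndsBlock-1⇒0 l1 ([] , ())
  EndsBlock-1⇒0 l1 (x ∷ [] , ())
  EndsBlock-1⇒0 l1 (x ∷ y ∷ z , e) = ⊥-elim ([]≢++∷ z l1 [] (∷-injectiveʳ (∷-injectiveʳ e)))
  EndsBlock-1⇒0 l2 ([] , ())
  EndsBlock-1⇒0 l2 (x ∷ z , e) with ∷-injectiveʳ e
  ... | e' = ⊥-elim ([]≢++∷ z l1 [] e')

  EndsBlock-22⇒1 : ∀ x → EndsBlock (l2 ∷ l2 ∷ []) x → x ≡ l1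
  EndsBlock-22⇒1 l1 _ = refl
  EndsBlock-22⇒1 l0 ([] , ())
  EndsBlock-22⇒1 l0 (x ∷ z , e) = ⊥-elim ([]≢++∷ z l2 (l2 ∷ []) (∷-injectiveʳ e))
  EndsBlock-22⇒1 l2 ([] , ())
  EndsBlock-22⇒1 l2 (x ∷ z , e) = ⊥-elim ([]≢++∷ z l2 (l2 ∷ []) (∷-injectiveʳ e))

  -- The nonempty suffixes, and equally the nonempty prefixes, of the block of a letter.
  data BlockPiece : Letter → Word → Set where
    piece-1 : BlockPiece l0 (l1 ∷ [])
    piece-22 : BlockPiece l1 (l2 ∷ l2 ∷ [])
    piece-2 : ∀ {b} → b ≢ l0 → BlockPiece b (l2 ∷ [])

  suffix-BlockPiece : ∀ b z t → qᶠ b ≡ z ++ t → t ≢ [] → BlockPiece b t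
  suffix-BlockPiece l0 [] t refl _ = piece-1
  suffix-BlockPiece l0 (x ∷ z) t e ne = ⊥-elim (ne (++-conicalʳ z t (sym (∷-injectiveʳ e))))
  suffix-BlockPiece l1 [] t refl _ = piece-22
  suffix-BlockPiece l1 (x ∷ []) t e ne with ∷-injective e
  ... | refl , refl = piece-2 (λ ())
  suffix-BlockPiece l1 (x ∷ y ∷ z) t e ne = ⊥-elim (ne (++-conicalʳ z t (sym (∷-injectiveʳ (∷-injectiveʳ e)))))
  suffix-BlockPiece l2 [] t refl _ = piece-2 (λ ())
  suffix-BlockPiece l2 (x ∷ z) t e ne = ⊥-elim (ne (++-conicalʳ z t (sym (∷-injectiveʳ e))))

  prefix-BlockPiece : ∀ b t s → qᶠ b ≡ t ++ s → t ≢ [] → BlockPiece b t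
  prefix-BlockPiece b [] s e ne = ⊥-elim (ne refl)
  prefix-BlockPiece l0 (x ∷ []) s e ne with ∷-injective e
  ... | refl , _ = piece-1
  prefix-BlockPiece l0 (x ∷ y ∷ t) s () ne
  prefix-BlockPiece l1 (x ∷ []) s e ne with ∷-injective e
  ... | refl , _ = piece-2 (λ ())
  prefix-BlockPiece l1 (x ∷ y ∷ []) s e ne with ∷-injective e
  ... | refl , e2 with ∷-injective e2
  ... | refl , _ = piece-22
  prefix-BlockPiece l1 (x ∷ y ∷ z ∷ t) s () ne
  prefix-BlockPiece l2 (x ∷ []) s e ne with ∷-injective e
  ... | refl , _ = piece-2 (λ ())
  prefix-BlockPiece l2 (x ∷ y ∷ t) s () ne

  firstTwo : ∀ W tW z x y d → MarkerFree tW → x ≢ l0 → y ≢ l0 → W ≡ tW ++ l0 ∷ z → W ≡ x ∷ y ∷ d →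
    Σ Word λ r → tW ≡ x ∷ y ∷ r
  firstTwo W [] z x y d _ nx ny refl e2 = ⊥-elim (nx (sym (∷-injectiveˡ e2)))
  firstTwo W (x' ∷ []) z x y d _ nx ny refl e2 = ⊥-elim (ny (sym (∷-injectiveˡ (∷-injectiveʳ e2))))
  firstTwo W (x' ∷ y' ∷ r) z x y d _ nx ny refl e2 with ∷-injective e2
  ... | refl , e3 with ∷-injective e3
  ... | refl , _ = r , refl

  lastTwo : ∀ W y0 t2 a x y → MarkerFree t2 → x ≢ l0 → y ≢ l0 → W ≡ y0 ++ l0 ∷ t2 → W ≡ a ++ x ∷ y ∷ [] →
    Σ Word λ r → t2 ≡ r ++ x ∷ y ∷ []
  lastTwo W y0 t2 a x y ct nx ny e1 e2 with firstTwo (rev W) (rev t2) (rev y0) y x (rev a)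
      (MarkerFree-rev ct) ny nx
     (trans (cong rev e1) (rev-++-∷ y0 t2))
     (trans (cong rev e2) (trans (rev-++ a (x ∷ y ∷ [])) refl))
  ... | r , er = rev r , trans (sym (rev-involutive t2))
      (trans (cong rev er) (++-assoc (rev r) (x ∷ []) (y ∷ [])))

  unique-2⇒all-0 : ∀ A N → A ≢ [] → (∀ a d → A ++ φ N ++ l0 ∷ l2 ∷ [] ≡ a ++ l2 ∷ d → a ≡ [] ⊎ d ≡ []) →
    All (_≡ l0) N
  unique-2⇒all-0 A [] _ _ = []
  unique-2⇒all-0 A (l0 ∷ N) ne h = refl ∷ unique-2⇒all-0 (A ++ l0 ∷ l1 ∷ []) N (λ e → ne (++-conicalˡ A _ e))
    (λ a d e → h a d (trans (solve 3 (λ A B R → A ⊕ (B ⊕ R) ⊜ (A ⊕ B) ⊕ R) refl A (l0 ∷ l1 ∷ [])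
        (φ N ++ l0 ∷ l2 ∷ [])) e))
  unique-2⇒all-0 A (l1 ∷ N) ne h with h (A ++ l0 ∷ []) (l2 ∷ φ N ++ l0 ∷ l2 ∷ [])
     (solve 3 (λ A B R → A ⊕ (B ⊕ R) ⊜ (A ⊕ B) ⊕ R) refl A (l0 ∷ []) (l2 ∷ l2 ∷ φ N ++ l0 ∷ l2 ∷ []))
  ... | inj₁ e = ⊥-elim ([]≢++∷ A l0 [] (sym e))
  ... | inj₂ ()
  unique-2⇒all-0 A (l2 ∷ N) ne h with h (A ++ l0 ∷ []) (φ N ++ l0 ∷ l2 ∷ [])
     (solve 3 (λ A B R → A ⊕ (B ⊕ R) ⊜ (A ⊕ B) ⊕ R) refl A (l0 ∷ []) (l2 ∷ φ N ++ l0 ∷ l2 ∷ []))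
  ... | inj₁ e = ⊥-elim ([]≢++∷ A l0 [] (sym e))
  ... | inj₂ e = ⊥-elim ([]≢++∷ (φ N) l0 (l2 ∷ []) (sym e))

  Factor-block⇒Palindrome : ∀ w → (w ≡ []) ⊎ (Σ Letter λ B → Factor w (qᶠ B)) → Palindrome w
  Factor-block⇒Palindrome w (inj₁ refl) = refl
  Factor-block⇒Palindrome w (inj₂ (l0 , f)) = constant⇒Palindrome l1 w (All-Factor f (refl ∷ []))
  Factor-block⇒Palindrome w (inj₂ (l1 , f)) = constant⇒Palindrome l2 w (All-Factor f (refl ∷ refl ∷ []))
  Factor-block⇒Palindrome w (inj₂ (l2 , f)) = constant⇒Palindrome l2 w (All-Factor f (refl ∷ []))

  qᶠ-length : ∀ B → length (qᶠ B) ≤ 2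
  qᶠ-length l0 = s≤s z≤n
  qᶠ-length l1 = s≤s (s≤s z≤n)
  qᶠ-length l2 = s≤s z≤n

  next-letter-2 : ∀ M v' e' d → Ends2 e' →
    l2 ∷ l2 ∷ φ M ++ l0 ∷ l2 ∷ l2 ∷ [] ≡ l2 ∷ (l2 ∷ φ v' ++ l0 ∷ l2 ∷ []) ++ e' ∷ d → e' ≡ l2
  next-letter-2 M v' e' d be e with φ-Prefix-cancel v' M (l2 ∷ e' ∷ d) (l2 ∷ l2 ∷ []) ((λ ()) ∷ (λ ()) ∷ []) e3
    where
    e3 : φ v' ++ l0 ∷ l2 ∷ e' ∷ d ≡ φ M ++ l0 ∷ l2 ∷ l2 ∷ []
    e3 = sym (trans (∷-injectiveʳ (∷-injectiveʳ e)) (++-assoc (φ v') (l0 ∷ l2 ∷ []) (e' ∷ d)))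
  ... | M2 , eM = by-rest M2 e4
    where
    e4 : φ M2 ++ l0 ∷ l2 ∷ l2 ∷ [] ≡ l0 ∷ l2 ∷ e' ∷ d
    e4 = ++-cancelˡ (φ v') _ _ (trans (sym (++-assoc (φ v') (φ M2) _))
        (trans (cong (_++ l0 ∷ l2 ∷ l2 ∷ []) (sym (φ-++ v' M2)))
           (trans (cong (λ r → φ r ++ l0 ∷ l2 ∷ l2 ∷ []) (sym eM))
               (trans (∷-injectiveʳ (∷-injectiveʳ e)) (++-assoc (φ v') (l0 ∷ l2 ∷ []) (e' ∷ d))))))
    by-rest : ∀ M2 → φ M2 ++ l0 ∷ l2 ∷ l2 ∷ [] ≡ l0 ∷ l2 ∷ e' ∷ d → e' ≡ l2
    by-rest [] e5 = sym (∷-injectiveˡ (∷-injectiveʳ (∷-injectiveʳ e5)))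
    by-rest (l0 ∷ M3) ()
    by-rest (l1 ∷ M3) e5 = sym (∷-injectiveˡ (∷-injectiveʳ (∷-injectiveʳ e5)))
    by-rest (l2 ∷ M3) e5 = ⊥-elim (Ends2⇒≢0 e' be (head-0 M3 (sym (∷-injectiveʳ (∷-injectiveʳ e5)))))
      where
      head-0 : ∀ M3 → e' ∷ d ≡ φ M3 ++ l0 ∷ l2 ∷ l2 ∷ [] → e' ≡ l0
      head-0 [] e6 = ∷-injectiveˡ e6
      head-0 (x ∷ _) e6 = ∷-injectiveˡ e6

  ReturnsPalindromicAt : Word → Set
  ReturnsPalindromicAt p = ∀ w → Palindrome p → Lx w → CompleteReturn p w → Palindrome w

  BorderedReturnsPalindromicAt : Word → Set
  BorderedReturnsPalindromicAt v =
    Palindrome v → ∀ b N b' → Lx (b ∷ N ++ [ b' ]) → BorderedReturn Ends2 v (b ∷ N ++ [ b' ]) → Palindrome N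

  InductionHyp : ℕ → Set
  InductionHyp n = (∀ p → μ p < n → ReturnsPalindromicAt p) ×
      (∀ v → μ v + 4 < n → BorderedReturnsPalindromicAt v)

  Prefix-1 : ∀ p → Prefix p (l1 ∷ []) → p ≢ [] → p ≡ l1 ∷ []
  Prefix-1 [] _ ne = ⊥-elim (ne refl)
  Prefix-1 (x ∷ p) (s , e) ne with ∷-injective e
  ... | refl , e2 = cong (l1 ∷_) (++-conicalˡ p s (sym e2))

  Prefix-22 : ∀ p → Prefix p (l2 ∷ l2 ∷ []) → p ≢ [] → (p ≡ l2 ∷ []) ⊎ (p ≡ l2 ∷ l2 ∷ [])
  Prefix-22 [] _ ne = ⊥-elim (ne refl)
  Prefix-22 (x ∷ []) (s , e) ne with ∷-injective e
  ... | refl , _ = inj₁ refl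
  Prefix-22 (x ∷ y ∷ p) (s , e) ne with ∷-injective e
  ... | refl , e2 with ∷-injective e2
  ... | refl , e3 = inj₂ (cong (λ r → l2 ∷ l2 ∷ r) (++-conicalˡ p s (sym e3)))

  Prefix-2 : ∀ p → Prefix p (l2 ∷ []) → p ≢ [] → p ≡ l2 ∷ []
  Prefix-2 [] _ ne = ⊥-elim (ne refl)
  Prefix-2 (x ∷ p) (s , e) ne with ∷-injective e
  ... | refl , e2 = cong (l2 ∷_) (++-conicalˡ p s (sym e2))

  ∷ʳ-≢ : ∀ u v (x y : Letter) → x ≢ y → u ++ [ x ] ≢ v ++ [ y ]
  ∷ʳ-≢ u v x y ne e = ne (proj₂ (∷ʳ-injective {x = x} {y = y} u v e))

  ≢-++-longer : ∀ (u v : Word) → length u < length v → ∀ a → u ≢ a ++ v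
  ≢-++-longer u v lt a e = <-irrefl refl (≤-trans lt
      (≤-trans (m≤n+m (length v) (length a)) (≤-reflexive (trans (sym (length-++ a)) (cong length (sym e))))))

  return-markerFree-cases : ∀ p t N t2 b z b' s' k → InductionHyp (μ p) → MarkerFree p → p ≢ [] → Prefix p t →
    (Σ Word λ a' → t2 ≡ a' ++ p) → qᶠ b ≡ z ++ t → qᶠ b' ≡ t2 ++ s' → Factor (b ∷ N ++ [ b' ]) (X k) →
    CompleteReturn p (t ++ φ N ++ l0 ∷ t2) → Palindrome (t ++ φ N ++ l0 ∷ t2)
  return-markerFree-cases p t N t2 b z b' s' k IH cp pne pt (a' , ea') eb eb' fac ret@(_ , _ , once)
    with suffix-BlockPiece b z t eb (Prefix-≢[] p t pne pt) | prefix-BlockPiece b' t2 s' eb'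
        (Suffix-≢[] p t2 pne (a' , ea'))
  ... | piece-1 | piece-1 with refl ← Prefix-1 p pt pne =
    Palindrome-framed [ l1 ] N (Palindrome-inner l0 N l0
      (proj₁ IH [ l0 ] (s≤s (s≤s z≤n)) (l0 ∷ N ++ [ l0 ]) refl (Factor-X⇒Lx k fac)
          (CompleteReturn-block⁻¹ l0 N (λ ()) ret)))
  ... | piece-1 | piece-22 with refl ← Prefix-1 p pt pne = ⊥-elim (∷ʳ-≢ [ l2 ] a' l2 l1 (λ ()) ea')
  ... | piece-1 | piece-2 _ with refl ← Prefix-1 p pt pne = ⊥-elim (∷ʳ-≢ [] a' l2 l1 (λ ()) ea')
  ... | piece-22 | _ with Prefix-22 p pt pne
  ... | inj₁ refl with once [ l2 ] (φ N ++ l0 ∷ t2) refl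
  ...   | inj₁ ()
  ...   | inj₂ e = ⊥-elim ([]≢++∷ (φ N) l0 t2 (sym e))
  return-markerFree-cases p t N t2 b z b' s' k IH cp pne pt
      (a' , ea') eb eb' fac ret@(_ , _ , once) | piece-22 | piece-1 | inj₂ refl =
    ⊥-elim (∷ʳ-≢ [] (a' ++ [ l2 ]) l1 l2 (λ ()) (trans ea' (sym (++-assoc a' [ l2 ] [ l2 ]))))
  return-markerFree-cases p t N t2 b z b' s' k IH cp pne pt
      (a' , ea') eb eb' fac ret@(_ , _ , once) | piece-22 | piece-2 _ | inj₂ refl =
    ⊥-elim (≢-++-longer [ l2 ] (l2 ∷ l2 ∷ []) (s≤s (s≤s z≤n)) a' ea')
  return-markerFree-cases p t N t2 b z b' s' k IH cp pne pt
      (a' , ea') eb eb' fac ret@(_ , _ , once) | piece-22 | piece-22 | inj₂ refl =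
    Palindrome-framed (l2 ∷ l2 ∷ []) N (Palindrome-inner l1 N l1
      (proj₁ IH [ l1 ] (s≤s (s≤s (s≤s z≤n))) (l1 ∷ N ++ [ l1 ]) refl (Factor-X⇒Lx k fac)
          (CompleteReturn-block⁻¹ l1 N (λ ()) ret)))
  return-markerFree-cases p t N t2 b z b' s' k IH cp pne pt
      (a' , ea') eb eb' fac ret@(_ , _ , once) | piece-2 _ | _ with Prefix-2 p pt pne
  return-markerFree-cases p t N t2 b z b' s' k IH cp pne pt
      (a' , ea') eb eb' fac ret@(_ , _ , once) | piece-2 _ | piece-1 | refl =
      ⊥-elim (∷ʳ-≢ [] a' l1 l2 (λ ()) ea')
  return-markerFree-cases p t N t2 b z b' s' k IH cp pne pt
      (a' , ea') eb eb' fac ret@(_ , _ , once) | piece-2 _ | piece-22 | refl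
    with once (l2 ∷ φ N ++ [ l0 ]) [ l2 ] (cong (l2 ∷_) (sym (++-assoc (φ N) [ l0 ] (l2 ∷ l2 ∷ []))))
  ... | inj₁ ()
  ... | inj₂ ()
  return-markerFree-cases p t N t2 b z b' s' k IH cp pne pt
      (a' , ea') eb eb' fac ret@(_ , _ , once) | piece-2 _ | piece-2 _ | refl =
    Palindrome-framed [ l2 ] N (constant⇒Palindrome l0 N (unique-2⇒all-0 [ l2 ] N (λ ()) once))

  return-to-markerFree-palindromic : ∀ p k w → InductionHyp (μ p) → MarkerFree p → p ≢ [] → Factor w (Φ (X k)) →
    ¬ MarkerFree w → CompleteReturn p w → Palindrome w
  return-to-markerFree-palindromic p k w IH cp pne fw ncw ret with parse (X k) w fw ncw
  ... | t , N , t2 , L , R , refl , ct , ct2 , fac , lok , rok = by-borders lok rok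
    where
    pt = proj₁ (CompleteReturn-markerFree-ends p t N t2 cp ret)
    sp = proj₂ (CompleteReturn-markerFree-ends p t N t2 cp ret)
    by-borders : LeftBorder t L → RightBorder t2 R → Palindrome (t ++ φ N ++ l0 ∷ t2)
    by-borders (inj₁ (te , _)) _ = ⊥-elim (Prefix-≢[] p t pne pt te)
    by-borders (inj₂ _) (inj₁ (te , _)) = ⊥-elim (Suffix-≢[] p t2 pne sp te)
    by-borders (inj₂ (b , eL , z , eb)) (inj₂ (b' , eR , (s' , eb'))) =
      return-markerFree-cases p t N t2 b z b' s' k IH cp pne pt sp eb eb'
          (subst₂ (λ L R → Factor (L ++ N ++ R) (X k)) eL eR fac) ret

  Palindrome-wrap : ∀ a v → Palindrome v → Palindrome (a ∷ v ++ [ a ])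
  Palindrome-wrap a v pv = cong (_++ [ a ]) (trans (rev-++ v [ a ]) (cong (a ∷_) pv))

  return-framed-cases : ∀ t v N L R k → InductionHyp (μ (t ++ φ v ++ l0 ∷ rev t)) → MarkerFree t → Palindrome v →
    Factor (L ++ N ++ R) (X k) → LeftBorder t L → RightBorder (rev t) R →
    CompleteReturn (t ++ φ v ++ l0 ∷ rev t) (t ++ φ N ++ l0 ∷ rev t) → Palindrome (t ++ φ N ++ l0 ∷ rev t)
  return-framed-cases [] v N L R k IH ct pv fac lok rok ret =
    Palindrome-framed [] N (proj₁ IH v (≤-<-trans (m≤m+n (μ v) 0) (μ-framed-> [] v)) N pv
      (Factor-X⇒Lx k (Factor-trans (L , R , refl) fac)) (CompleteReturn-Φ⁻¹ v N ret))
  return-framed-cases (x ∷ t') v N L R k IH ct pv fac (inj₁ (() , _)) rok ret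
  return-framed-cases (x ∷ t') v N L R k IH ct pv fac (inj₂ (b , refl , z , eb)) (inj₁ (e , _)) ret =
      ⊥-elim ([]≢++∷ (rev t') x [] (sym e))
  return-framed-cases (x ∷ t') v N L R k IH ct pv fac (inj₂ (b , refl , z , eb))
      (inj₂ (b' , refl , pr')) ret with suffix-BlockPiece b z (x ∷ t') eb (λ ())
  ... | piece-1 with EndsBlock-1⇒0 b' (Prefix-rev⇒EndsBlock (l1 ∷ []) b' pr')
  ... | refl = Palindrome-framed (l1 ∷ []) N
      (Palindrome-inner l0 N l0 (proj₁ IH (l0 ∷ v ++ [ l0 ]) lt _ (Palindrome-wrap l0 v pv) (Factor-X⇒Lx k fac)
                 (CompleteReturn-framed⁻¹ [ l1 ] v N l0 (λ ()) ct (z , eb) EndsBlock-1⇒0 ret)))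
    where
    lt : μ (l0 ∷ v ++ [ l0 ]) < μ ((l1 ∷ []) ++ φ v ++ l0 ∷ rev (l1 ∷ []))
    lt = wrap<framed l0 (l1 ∷ []) v (s≤s (s≤s z≤n))
  return-framed-cases (x ∷ t') v N L R k IH ct pv fac (inj₂ (b , refl , z , eb))
      (inj₂ (b' , refl , pr')) ret | piece-22 with EndsBlock-22⇒1 b'
      (Prefix-rev⇒EndsBlock (l2 ∷ l2 ∷ []) b' pr')
  ... | refl = Palindrome-framed (l2 ∷ l2 ∷ []) N
      (Palindrome-inner l1 N l1 (proj₁ IH (l1 ∷ v ++ [ l1 ]) lt _ (Palindrome-wrap l1 v pv) (Factor-X⇒Lx k fac)
                 (CompleteReturn-framed⁻¹ (l2 ∷ l2 ∷ []) v N l1 (λ ()) ct (z , eb) EndsBlock-22⇒1 ret)))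
    where
    lt : μ (l1 ∷ v ++ [ l1 ]) < μ ((l2 ∷ l2 ∷ []) ++ φ v ++ l0 ∷ rev (l2 ∷ l2 ∷ []))
    lt = wrap<framed l1 (l2 ∷ l2 ∷ []) v (s≤s (s≤s (s≤s (s≤s z≤n))))
  return-framed-cases (x ∷ t') v N L R k IH ct pv fac (inj₂ (b , refl , z , eb))
      (inj₂ (b' , refl , pr')) ret | piece-2 _ =
    Palindrome-framed (l2 ∷ []) N (proj₂ IH v lt pv b N b' (Factor-X⇒Lx k fac)
        (BorderedReturn-framed⁻¹ (l2 ∷ []) v N b b' (λ ()) ct (z , eb)
        (Prefix-rev⇒EndsBlock (l2 ∷ []) b' pr') ret))
    where
    lt : μ v + 4 < μ ((l2 ∷ []) ++ φ v ++ l0 ∷ rev (l2 ∷ []))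
    lt = μ-framed-> (l2 ∷ []) v

  return-to-framed-palindromic : ∀ p k w → InductionHyp (μ p) → Palindrome p → ¬ MarkerFree p →
    Factor w (Φ (X k)) → CompleteReturn p w → Palindrome w
  return-to-framed-palindromic p k w IH pp ncp fw ret with parseReturn (X k) p w fw pp ncp ret
  ... | t , v , N , L , R , ct , pv , refl , refl , fac , lok , rok = return-framed-cases t v N L R k IH ct pv fac lok rok ret

  returnsPalindromic-step : ∀ p → InductionHyp (μ p) → ReturnsPalindromicAt p
  returnsPalindromic-step [] IH w pp lw ret = CompleteReturn-[]⇒Palindrome w ret
  returnsPalindromic-step (x ∷ p) IH w pp (k , fw) ret with markerFree? w
  ... | yes cw = Factor-block⇒Palindrome w (markerFree-Factor-Φ (X k) w fw cw)
  ... | no ncw with markerFree? (x ∷ p)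
  ... | yes cp = return-to-markerFree-palindromic (x ∷ p) k w IH cp (λ ()) fw ncw ret
  ... | no ncp = return-to-framed-palindromic (x ∷ p) k w IH pp ncp fw ret

  short-inner-[] : ∀ (a : Letter) v (b : Letter) → length (a ∷ v ++ [ b ]) ≤ 2 → v ≡ []
  short-inner-[] a [] b _ = refl
  short-inner-[] a (_ ∷ []) b (s≤s (s≤s ()))
  short-inner-[] a (_ ∷ _ ∷ _) b (s≤s (s≤s ()))

  wrapped-2-inner : ∀ (b : Letter) N (b' : Letter) Y → b ∷ N ++ [ b' ] ≡ l2 ∷ Y ++ [ l2 ] → N ≡ Y
  wrapped-2-inner b N b' Y e = proj₁ (∷ʳ-injective N Y (∷-injectiveʳ e))

  shape-22 : ∀ M →
    (l2 ∷ l2 ∷ []) ++ φ M ++ l0 ∷ l2 ∷ l2 ∷ [] ≡ l2 ∷ ((l2 ∷ []) ++ φ M ++ l0 ∷ rev (l2 ∷ [])) ++ [ l2 ]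
  shape-22 M = cong (λ r → l2 ∷ l2 ∷ r) (sym (++-assoc (φ M) (l0 ∷ l2 ∷ []) (l2 ∷ [])))

  bordered-empty-cases : ∀ k b N b' M L R → InductionHyp 4 →
    b ∷ N ++ [ b' ] ≡ (l2 ∷ l2 ∷ []) ++ φ M ++ l0 ∷ l2 ∷ l2 ∷ [] → Factor (L ++ M ++ R) (X k) → L ≡ [ l1 ] →
    R ≡ [ l1 ] → BorderedReturn Ends2 [] (b ∷ N ++ [ b' ]) → Palindrome N
  bordered-empty-cases k b N b' M L R IH eW fac refl refl (_ , _ , int) =
    subst Palindrome (sym (wrapped-2-inner b N b' _ (trans eW (shape-22 M)))) (Palindrome-framed (l2 ∷ []) M pM)
    where
    ret : CompleteReturn (qᶠ l1) (qᶠ l1 ++ φ M ++ l0 ∷ qᶠ l1)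
    ret = (φ M ++ l0 ∷ qᶠ l1 , refl) , ((l2 ∷ l2 ∷ []) ++ φ M ++ l0 ∷ [] , solve 3
        (λ Q F C → Q ⊕ (F ⊕ (C ⊕ Q)) ⊜ (Q ⊕ (F ⊕ C)) ⊕ Q) refl (qᶠ l1) (φ M) (l0 ∷ [])) ,
          λ a d e → int a d l2 l2 Ends2-2 Ends2-2 (trans eW e)
    pM : Palindrome M
    pM = Palindrome-inner l1 M l1 (proj₁ IH (l1 ∷ []) (s≤s (s≤s (s≤s z≤n))) (l1 ∷ M ++ [ l1 ]) refl
        (Factor-X⇒Lx k fac) (CompleteReturn-block⁻¹ l1 M (λ ()) ret))

  bordered-return-empty : ∀ k b N b' → InductionHyp 4 → Factor (b ∷ N ++ [ b' ]) (Φ (X k)) →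
    BorderedReturn Ends2 [] (b ∷ N ++ [ b' ]) → Palindrome N
  bordered-return-empty k b N b' IH fW rb with markerFree? (b ∷ N ++ [ b' ])
  ... | yes cW with markerFree-Factor-Φ (X k) (b ∷ N ++ [ b' ]) fW cW
  ...   | inj₁ ()
  ...   | inj₂ (B' , fB') = subst Palindrome
      (sym (short-inner-[] b N b' (≤-trans (length-Factor fB') (qᶠ-length B')))) refl
  bordered-return-empty k b N b' IH fW rb@((e , e' , d , be , be' , es) , (a , ff , f' , bf , bf' , ea) , _) | no ncW
    with parse (X k) (b ∷ N ++ [ b' ]) fW ncW
  ... | tW , M , t2W , L , R , eW , ctW , ct2W , fac , lok , rok = by-borders lok rok
    where
    ft : Σ Word λ r → tW ≡ e ∷ e' ∷ r
    ft = firstTwo _ tW (proj₁ (φ-++-marker M t2W)) e e' d ctW (Ends2⇒≢0 e be) (Ends2⇒≢0 e' be')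
        (trans eW (cong (tW ++_) (proj₂ (φ-++-marker M t2W)))) es
    lt2 : Σ Word λ r → t2W ≡ r ++ ff ∷ f' ∷ []
    lt2 = lastTwo _ (tW ++ φ M) t2W a ff f' ct2W (Ends2⇒≢0 ff bf) (Ends2⇒≢0 f' bf')
        (trans eW (sym (++-assoc tW (φ M) (l0 ∷ t2W)))) ea
    tne : tW ≢ []
    tne te = []≢++∷ [] e (e' ∷ proj₁ ft) (trans (sym te) (proj₂ ft))
    t2ne : t2W ≢ []
    t2ne te = []≢++∷ (proj₁ lt2) ff (f' ∷ []) (trans (sym te) (proj₂ lt2))
    by-borders : LeftBorder tW L → RightBorder t2W R → Palindrome N
    by-borders (inj₁ (te , _)) _ = ⊥-elim (tne te)
    by-borders (inj₂ _) (inj₁ (te , _)) = ⊥-elim (t2ne te)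
    by-borders (inj₂ (B1 , eL , z , eb)) (inj₂ (B2' , eR , (s' , eb'))) = by-pieces tW t2W ctW ct2W eW ft lt2
        (suffix-BlockPiece B1 z tW eb tne) (prefix-BlockPiece B2' t2W s' eb' t2ne) eL eR fac
      where
      by-pieces : ∀ tW t2W → MarkerFree tW → MarkerFree t2W → b ∷ N ++ [ b' ] ≡ tW ++ φ M ++ l0 ∷ t2W →
        (Σ Word λ r → tW ≡ e ∷ e' ∷ r) → (Σ Word λ r → t2W ≡ r ++ ff ∷ f' ∷ []) → BlockPiece B1 tW →
        BlockPiece B2' t2W → L ≡ [ B1 ] → R ≡ [ B2' ] → Factor (L ++ M ++ R) (X k) → Palindrome N
      by-pieces _ _ _ _ eW' (r , ()) lr piece-1 _ _ _ _
      by-pieces _ _ _ _ eW' (r , ()) lr (piece-2 _) _ _ _ _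
      by-pieces _ _ _ _ eW' fr (r2 , e2) piece-22 piece-1 _ _ _ =
          ⊥-elim (≢-++-longer (l1 ∷ []) (ff ∷ f' ∷ []) (s≤s (s≤s z≤n)) r2 e2)
      by-pieces _ _ _ _ eW' fr (r2 , e2) piece-22 (piece-2 _) _ _ _ =
          ⊥-elim (≢-++-longer (l2 ∷ []) (ff ∷ f' ∷ []) (s≤s (s≤s z≤n)) r2 e2)
      by-pieces _ _ _ _ eW' fr lr piece-22 piece-22 eL' eR' fac' = bordered-empty-cases k b N b' M L R IH eW' fac' eL' eR' rb

  qᶠ-last-Ends2 : ∀ x → Σ Word λ z → Σ Letter λ e → (qᶠ x ≡ z ++ [ e ]) × Ends2 e
  qᶠ-last-Ends2 l0 = [] , l1 , refl , Ends2-1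
  qᶠ-last-Ends2 l1 = l2 ∷ [] , l2 , refl , Ends2-2
  qᶠ-last-Ends2 l2 = [] , l2 , refl , Ends2-2

  qᶠ-first-Ends2 : ∀ x → Σ Letter λ e → Σ Word λ z → (qᶠ x ≡ e ∷ z) × Ends2 e
  qᶠ-first-Ends2 l0 = l1 , [] , refl , Ends2-1
  qᶠ-first-Ends2 l1 = l2 , l2 ∷ [] , refl , Ends2-2
  qᶠ-first-Ends2 l2 = l2 , [] , refl , Ends2-2

  open FramedBorders Ends2 Ends2⇒≢0 qᶠ-last-Ends2 qᶠ-first-Ends2

  bordered-return-bare : ∀ k b N b' v' M L R → InductionHyp (μ (φ v' ++ l0 ∷ []) + 4) → Palindrome v' →
    b ∷ N ++ [ b' ] ≡ b ∷ φ M ++ l0 ∷ [ b' ] → Factor (L ++ M ++ R) (X k) →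
    BorderedReturn Ends2 (φ v' ++ l0 ∷ []) (b ∷ N ++ [ b' ]) → Palindrome N
  bordered-return-bare k b N b' v' M L R IH pv' eW fac rb = subst Palindrome (sym eN)
      (Palindrome-framed [] M pM)
    where
    eN : N ≡ φ M ++ [ l0 ]
    eN = proj₁ (∷ʳ-injective N (φ M ++ [ l0 ]) (trans (∷-injectiveʳ eW) (sym (++-assoc (φ M) [ l0 ] [ b' ]))))
    lt : μ v' < μ (φ v' ++ l0 ∷ []) + 4
    lt = <-≤-trans (≤-<-trans (m≤m+n (μ v') 0) (μ-framed-> [] v')) (m≤m+n _ 4)
    pM : Palindrome M
    pM = proj₁ IH v' lt M pv' (Factor-X⇒Lx k (Factor-trans (L , R , refl) fac))
        (BorderedReturn-Φ⁻¹ v' b M b' (subst (λ N → BorderedReturn Ends2 _ (b ∷ N ++ [ b' ])) eN rb))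

  bordered-return-22 : ∀ k N v' M L R → InductionHyp (μ ((l2 ∷ []) ++ φ v' ++ l0 ∷ rev (l2 ∷ [])) + 4) →
    Palindrome v' → l2 ∷ N ++ [ l2 ] ≡ (l2 ∷ l2 ∷ []) ++ φ M ++ l0 ∷ l2 ∷ l2 ∷ [] → Factor (L ++ M ++ R) (X k) →
    L ≡ [ l1 ] → R ≡ [ l1 ] → BorderedReturn Ends2 ((l2 ∷ []) ++ φ v' ++ l0 ∷ rev (l2 ∷ []))
        (l2 ∷ N ++ [ l2 ]) →
    Palindrome N
  bordered-return-22 k N v' M L R IH pv' eW fac refl refl
      ((e , e' , d , be , be' , es) , (a , ff , f' , bf , bf' , ea) , int)
    with ∷-injectiveˡ es | proj₂ (∷ʳ-injective (l2 ∷ N) (a ++ ff ∷ (l2 ∷ []) ++ φ v' ++ l0 ∷ rev (l2 ∷ []))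
           (trans ea (solve 4 (λ A F V G → A ⊕ (F ⊕ (V ⊕ G)) ⊜ (A ⊕ (F ⊕ V)) ⊕ G) refl a [ ff ]
               ((l2 ∷ []) ++ φ v' ++ l0 ∷ rev (l2 ∷ [])) [ f' ])))
  ... | refl | refl with next-letter-2 M v' e' d be' (trans (sym eW) es)
  ... | refl with next-letter-2 (rev M) v' ff (rev a) bf eq2
    where
    v = (l2 ∷ []) ++ φ v' ++ l0 ∷ rev (l2 ∷ [])
    pv : Palindrome v
    pv = Palindrome-framed (l2 ∷ []) v' pv'
    eq2 : l2 ∷ l2 ∷ φ (rev M) ++ l0 ∷ l2 ∷ l2 ∷ [] ≡ l2 ∷ (l2 ∷ φ v' ++ l0 ∷ l2 ∷ []) ++ ff ∷ rev a
    eq2 = begin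
        l2 ∷ l2 ∷ φ (rev M) ++ l0 ∷ l2 ∷ l2 ∷ []
      ≡⟨ sym (rev-framed-sym (l2 ∷ l2 ∷ []) M) ⟩
        rev ((l2 ∷ l2 ∷ []) ++ φ M ++ l0 ∷ l2 ∷ l2 ∷ [])
      ≡⟨ cong rev (sym eW) ⟩
        rev (l2 ∷ N ++ [ l2 ])
      ≡⟨ cong rev ea ⟩
        rev (a ++ ff ∷ v ++ [ l2 ])
      ≡⟨ rev-++ a (ff ∷ v ++ [ l2 ]) ⟩
        (rev (v ++ [ l2 ]) ++ [ ff ]) ++ rev a
      ≡⟨ cong (λ r → (r ++ [ ff ]) ++ rev a) (trans (rev-++ v [ l2 ]) (cong (l2 ∷_) pv)) ⟩
        ((l2 ∷ v) ++ [ ff ]) ++ rev a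
      ≡⟨ cong (l2 ∷_) (++-assoc v [ ff ] (rev a)) ⟩
        l2 ∷ (v ++ ff ∷ rev a)
      ∎
      where open ≡-Reasoning
  ... | refl = subst Palindrome (sym (wrapped-2-inner l2 N l2 _ (trans eW (shape-22 M))))
      (Palindrome-framed (l2 ∷ []) M pM)
    where
    v = (l2 ∷ []) ++ φ v' ++ l0 ∷ rev (l2 ∷ [])
    W = l2 ∷ N ++ [ l2 ]
    p' = l2 ∷ v ++ [ l2 ]
    p'eq : p' ≡ (l2 ∷ l2 ∷ []) ++ φ v' ++ l0 ∷ rev (l2 ∷ l2 ∷ [])
    p'eq = cong (λ r → l2 ∷ l2 ∷ r) (solve 3 (λ F C G → (F ⊕ C) ⊕ G ⊜ F ⊕ (C ⊕ G)) refl (φ v')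
        (l0 ∷ l2 ∷ []) [ l2 ])
    ret1 : CompleteReturn p' W
    ret1 = (d , trans es (cong (l2 ∷_) (solve 3 (λ V E D → V ⊕ (E ⊕ D) ⊜ (V ⊕ E) ⊕ D) refl v [ l2 ] d))) ,
           (a , ea) ,
           (λ a' d' e0 → int a' d' l2 l2 Ends2-2 Ends2-2
               (trans e0 (cong (a' ++_) (cong (l2 ∷_) (solve 3
               (λ V E D → (V ⊕ E) ⊕ D ⊜ V ⊕ (E ⊕ D)) refl v [ l2 ] d')))))
    ret2 : CompleteReturn ((l2 ∷ l2 ∷ []) ++ φ v' ++ l0 ∷ rev (l2 ∷ l2 ∷ [])) ((l2 ∷ l2 ∷ []) ++ φ M ++ l0 ∷ rev (l2 ∷ l2 ∷ []))
    ret2 = subst₂ CompleteReturn p'eq eW ret1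
    ret3 : CompleteReturn (l1 ∷ v' ++ [ l1 ]) (l1 ∷ M ++ [ l1 ])
    ret3 = CompleteReturn-framed⁻¹ (l2 ∷ l2 ∷ []) v' M l1 (λ ()) ((λ ()) ∷ (λ ()) ∷ [])
        ([] , refl) EndsBlock-22⇒1 ret2
    lt : μ (l1 ∷ v' ++ [ l1 ]) < μ v + 4
    lt = <-≤-trans (wrap<framed l1 (l2 ∷ []) v' ≤-refl) (m≤m+n _ 4)
    pM : Palindrome M
    pM = Palindrome-inner l1 M l1 (proj₁ IH (l1 ∷ v' ++ [ l1 ]) lt _ (Palindrome-wrap l1 v' pv')
        (Factor-X⇒Lx k fac) ret3)

  bordered-return-framed-cases : ∀ k b N b' tv v' M L R → InductionHyp (μ (tv ++ φ v' ++ l0 ∷ rev tv) + 4) →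
    Palindrome v' → b ∷ N ++ [ b' ] ≡ (b ∷ tv) ++ φ M ++ l0 ∷ (rev tv ++ [ b' ]) → Factor (L ++ M ++ R) (X k) →
    LeftBorder (b ∷ tv) L → RightBorder (rev tv ++ [ b' ]) R →
    BorderedReturn Ends2 (tv ++ φ v' ++ l0 ∷ rev tv) (b ∷ N ++ [ b' ]) → Palindrome N
  bordered-return-framed-cases k b N b' tv v' M L R IH pv' eW fac (inj₁ (() , _)) rok rb
  bordered-return-framed-cases k b N b' tv v' M L R IH pv' eW fac
      (inj₂ (B1 , eL , z , eb)) rok rb with suffix-BlockPiece B1 z (b ∷ tv) eb (λ ())
  ... | piece-1 = bordered-return-bare k l1 N b' v' M L R IH pv' eW fac rb
  ... | piece-2 _ = bordered-return-bare k l2 N b' v' M L R IH pv' eW fac rb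
  ... | piece-22 with rok
  ...   | inj₁ (() , _)
  ...   | inj₂ (B2' , eR , (s' , eb')) with prefix-BlockPiece B2' (l2 ∷ b' ∷ []) s' eb' (λ ())
  ...   | piece-22 = bordered-return-22 k N v' M L R IH pv' eW fac eL eR rb

  bordered-return-framed : ∀ v k b N b' → InductionHyp (μ v + 4) → Palindrome v → ¬ MarkerFree v →
    Factor (b ∷ N ++ [ b' ]) (Φ (X k)) → BorderedReturn Ends2 v (b ∷ N ++ [ b' ]) → Palindrome N
  bordered-return-framed v k b N b' IH pv ncv fW rb@((e , e' , d , be , be' , es) ,
      (a , ff , f' , bf , bf' , ea) , int)
    with parse (X k) v (Factor-trans (e ∷ [] , e' ∷ d , es) fW) ncv
  ... | tv , v' , t2v , _ , _ , refl , ctv , ct2v , _ , _ , _ with Palindrome-framed⁻¹ tv v' t2v ctv ct2v pv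
  ... | refl , pv' with parse (X k) (b ∷ N ++ [ b' ]) fW (λ cW → ncv (All-Factor (e ∷ [] , e' ∷ d , es) cW))
  ... | tW , M , t2W , L , R , eW , ctW , ct2W , fac , lok , rok with ∷-injectiveˡ es
  ... | refl with firstMarker-unique tW (proj₁ (φ-++-marker M t2W)) (b ∷ tv)
      (proj₁ (φ-++-marker v' (rev tv)) ++ e' ∷ d) ctW (Ends2⇒≢0 b be ∷ ctv) eqA
    where
    eqA : tW ++ l0 ∷ proj₁ (φ-++-marker M t2W) ≡ (b ∷ tv) ++ l0 ∷ (proj₁ (φ-++-marker v' (rev tv)) ++ e' ∷ d)
    eqA = begin
        tW ++ l0 ∷ proj₁ (φ-++-marker M t2W)
      ≡⟨ cong (tW ++_) (sym (proj₂ (φ-++-marker M t2W))) ⟩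
        tW ++ φ M ++ l0 ∷ t2W
      ≡⟨ sym eW ⟩
        b ∷ N ++ [ b' ]
      ≡⟨ es ⟩
        b ∷ (tv ++ φ v' ++ l0 ∷ rev tv) ++ e' ∷ d
      ≡⟨ cong (b ∷_) (solve 3 (λ T X D → (T ⊕ X) ⊕ D ⊜ T ⊕ (X ⊕ D)) refl tv (φ v' ++ l0 ∷ rev tv) (e' ∷ d)) ⟩
        b ∷ tv ++ (φ v' ++ l0 ∷ rev tv) ++ e' ∷ d
      ≡⟨ cong (λ r → b ∷ tv ++ r ++ e' ∷ d) (proj₂ (φ-++-marker v' (rev tv))) ⟩
        (b ∷ tv) ++ l0 ∷ (proj₁ (φ-++-marker v' (rev tv)) ++ e' ∷ d)
      ∎
      where open ≡-Reasoning
  ... | refl with proj₂ (∷ʳ-injective (b ∷ N) (a ++ ff ∷ tv ++ φ v' ++ l0 ∷ rev tv)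
                   (trans ea (solve 4 (λ A F V G → A ⊕ (F ⊕ (V ⊕ G)) ⊜ (A ⊕ (F ⊕ V)) ⊕ G) refl a [ ff ]
                       (tv ++ φ v' ++ l0 ∷ rev tv) [ f' ])))
  ... | refl with lastMarker-unique ((b ∷ tv) ++ φ M) t2W (a ++ ff ∷ tv ++ φ v') (rev tv ++ [ b' ]) ct2W
      (++⁺ (MarkerFree-rev ctv) (Ends2⇒≢0 b' bf' ∷ [])) eqB
    where
    eqB : ((b ∷ tv) ++ φ M) ++ l0 ∷ t2W ≡ (a ++ ff ∷ tv ++ φ v') ++ l0 ∷ (rev tv ++ [ b' ])
    eqB = begin
        ((b ∷ tv) ++ φ M) ++ l0 ∷ t2W
      ≡⟨ ++-assoc (b ∷ tv) (φ M) (l0 ∷ t2W) ⟩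
        (b ∷ tv) ++ φ M ++ l0 ∷ t2W
      ≡⟨ sym eW ⟩
        b ∷ N ++ [ b' ]
      ≡⟨ ea ⟩
        a ++ ff ∷ (tv ++ φ v' ++ l0 ∷ rev tv) ++ [ b' ]
      ≡⟨ solve 7 (λ A F T V C R B → A ⊕ (F ⊕ ((T ⊕ (V ⊕ (C ⊕ R))) ⊕ B)) ⊜ (A ⊕ (F ⊕ (T ⊕ V))) ⊕ (C ⊕ (R ⊕ B)))
           refl a [ ff ] tv (φ v') [ l0 ] (rev tv) [ b' ] ⟩
        (a ++ ff ∷ tv ++ φ v') ++ l0 ∷ (rev tv ++ [ b' ])
      ∎
      where open ≡-Reasoning
  ... | refl = bordered-return-framed-cases k b N b' tv v' M L R IH pv' eW fac lok rok rb

  borderedReturnsPalindromic-step : ∀ v → InductionHyp (μ v + 4) → BorderedReturnsPalindromicAt v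
  borderedReturnsPalindromic-step v IH pv b N b' (k , fW) rb with markerFree? v
  ... | no ncv = bordered-return-framed v k b N b' IH pv ncv fW rb
  ... | yes cv with rb
  ... | ((e , e' , d , be , be' , es) , _ , _)
    with markerFree-Factor-Φ (X k) (e ∷ v ++ [ e' ])
        (Factor-trans (Prefix⇒Factor (d , trans es (cong (e ∷_) (sym (++-assoc v [ e' ] d))))) fW)
                (Ends2⇒≢0 e be ∷ ++⁺ cv (Ends2⇒≢0 e' be' ∷ []))
  ... | inj₁ ()
  ... | inj₂ (B , fB) with short-inner-[] e v e' (≤-trans (length-Factor fB) (qᶠ-length B))
  ... | refl = bordered-return-empty k b N b' IH fW rb

  InductionHyp-mono : ∀ {m n} → m ≤ n → InductionHyp n → InductionHyp m
  InductionHyp-mono le (h1 , h2) = (λ p lt → h1 p (≤-trans lt le)) , (λ v lt → h2 v (≤-trans lt le))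

  inductionHyp : ∀ n → InductionHyp n
  inductionHyp zero = (λ p ()) , (λ v ())
  inductionHyp (suc n) = (λ p lt → returnsPalindromic-step p (InductionHyp-mono (pr lt) (inductionHyp n))) ,
      (λ v lt → borderedReturnsPalindromic-step v (InductionHyp-mono (pr lt) (inductionHyp n)))
    where
    pr : ∀ {a b} → suc a ≤ suc b → a ≤ b
    pr (s≤s x) = x

  Lx-returnsPalindromic : ReturnsPalindromic Lx
  Lx-returnsPalindromic p w pp lw ret = proj₁ (inductionHyp (suc (μ p))) p ≤-refl w pp lw ret

  X-Prefix : ∀ {a b} → a ≤ b → Prefix (X a) (X b)
  X-Prefix {a} {b} le = subst (λ n → Prefix (X a) (X n)) (m∸n+n≡m le) (chain (b ∸ a))
    where
    chain : ∀ j → Prefix (X a) (X (j + a))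
    chain zero = [] , sym (++-identityʳ (X a))
    chain (suc j) = Prefix-trans (chain j) (X-Prefix-suc (j + a))

  X-nonempty : ∀ k → Σ Letter λ a → Σ Word λ w → X k ≡ a ∷ w
  X-nonempty zero = l0 , [] , refl
  X-nonempty (suc k) = let a , w , e = X-nonempty k in l0 , qᶠ a ++ φ w , trans (X-suc k) (cong φ e)

  length-X : ∀ k → suc k ≤ length (X k)
  length-X zero = s≤s z≤n
  length-X (suc k) =
    let a , w , e = X-nonempty k
    in subst (λ r → suc (suc k) ≤ length r) (sym (trans (X-suc k) (cong φ e)))
         (s≤s (≤-trans (subst (suc k ≤_) (cong length e) (length-X k)) (block-length a w)))
    where
    block-length : ∀ a w → suc (length w) ≤ length (qᶠ a ++ φ w)
    block-length l0 w = s≤s (length-φ w)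
    block-length l1 w = s≤s (≤-trans (length-φ w) (n≤1+n _))
    block-length l2 w = s≤s (length-φ w)

  x-nth : ∀ n N → suc n ≤ N → x n ≡ nth (X N) n l0
  x-nth n N le = nth-Prefix (X (suc n)) (X N) n l0 (X-Prefix le) (≤-trans (n≤1+n (suc n)) (length-X (suc n)))

  window-x∈Lx : ∀ i m → Lx (window x i m)
  window-x∈Lx i m = Factor-X⇒Lx (i + m) (window-Factor x (X (i + m)) i m
    (λ k lt → x-nth (i + k) (i + m) (+-monoʳ-< i lt)) (≤-trans (n≤1+n (i + m)) (length-X (i + m))))

module FactorsOfY where

  open FactorsOfX using (X; Factor-X⇒Lx; Lx-returnsPalindromic; Palindrome-wrap; x-nth; length-X)

  qᵍ : Letter → Word
  qᵍ l0 = l0 ∷ []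
  qᵍ l1 = l1 ∷ []
  qᵍ l2 = []

  qᵍ-markerFree : ∀ a → All (_≢ l2) (qᵍ a)
  qᵍ-markerFree l0 = (λ ()) ∷ []
  qᵍ-markerFree l1 = (λ ()) ∷ []
  qᵍ-markerFree l2 = []

  qᵍ-palindrome : ∀ a → Palindrome (qᵍ a)
  qᵍ-palindrome l0 = refl
  qᵍ-palindrome l1 = refl
  qᵍ-palindrome l2 = refl

  qᵍ-injective : ∀ a b → qᵍ a ≡ qᵍ b → a ≡ b
  qᵍ-injective l0 l0 _ = refl
  qᵍ-injective l1 l1 _ = refl
  qᵍ-injective l2 l2 _ = refl
  qᵍ-injective l0 l1 ()
  qᵍ-injective l0 l2 ()
  qᵍ-injective l1 l0 ()
  qᵍ-injective l1 l2 ()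
  qᵍ-injective l2 l0 ()
  qᵍ-injective l2 l1 ()

  open Marker l2 qᵍ qᵍ-markerFree qᵍ-palindrome qᵍ-injective

  morph-g≡φ : ∀ w → morph g w ≡ φ w
  morph-g≡φ [] = refl
  morph-g≡φ (l0 ∷ w) = cong (λ r → l2 ∷ l0 ∷ r) (morph-g≡φ w)
  morph-g≡φ (l1 ∷ w) = cong (λ r → l2 ∷ l1 ∷ r) (morph-g≡φ w)
  morph-g≡φ (l2 ∷ w) = cong (λ r → l2 ∷ r) (morph-g≡φ w)

  Ly : Word → Set
  Ly w = Σ ℕ λ k → Factor w (Φ (X k))

  Ly-factorClosed : FactorClosed Ly
  Ly-factorClosed u w fu (k , fw) = k , Factor-trans fu fw

  markerFree? : (w : Word) → Dec (MarkerFree w)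
  markerFree? w = all? (λ a → ¬? (a ≟ l2)) w

  data BlockPiece : Letter → Word → Set where
    piece-0 : BlockPiece l0 (l0 ∷ [])
    piece-1 : BlockPiece l1 (l1 ∷ [])

  suffix-BlockPiece : ∀ b z t → qᵍ b ≡ z ++ t → t ≢ [] → BlockPiece b t
  suffix-BlockPiece l0 [] t refl _ = piece-0
  suffix-BlockPiece l1 [] t refl _ = piece-1
  suffix-BlockPiece l0 (x ∷ z) t e ne = ⊥-elim (ne (++-conicalʳ z t (sym (∷-injectiveʳ e))))
  suffix-BlockPiece l1 (x ∷ z) t e ne = ⊥-elim (ne (++-conicalʳ z t (sym (∷-injectiveʳ e))))
  suffix-BlockPiece l2 [] t refl ne = ⊥-elim (ne refl)
  suffix-BlockPiece l2 (x ∷ z) t () ne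

  prefix-BlockPiece : ∀ b t s → qᵍ b ≡ t ++ s → t ≢ [] → BlockPiece b t
  prefix-BlockPiece b [] s e ne = ⊥-elim (ne refl)
  prefix-BlockPiece l0 (x ∷ []) s e _ with ∷-injective e
  ... | refl , _ = piece-0
  prefix-BlockPiece l1 (x ∷ []) s e _ with ∷-injective e
  ... | refl , _ = piece-1
  prefix-BlockPiece l0 (x ∷ y ∷ t) s () _
  prefix-BlockPiece l1 (x ∷ y ∷ t) s () _
  prefix-BlockPiece l2 (x ∷ t) s () _

  EndsBlock-single : ∀ b → BlockPiece b (b ∷ []) → ∀ x → EndsBlock (b ∷ []) x → x ≡ b
  EndsBlock-single b sb x (z , e) with suffix-BlockPiece x z (b ∷ []) e (λ ())
  ... | piece-0 = refl
  ... | piece-1 = refl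

  length≤1⇒Palindrome : ∀ (w : Word) → length w ≤ 1 → Palindrome w
  length≤1⇒Palindrome [] _ = refl
  length≤1⇒Palindrome (x ∷ []) _ = refl
  length≤1⇒Palindrome (x ∷ y ∷ w) (s≤s ())

  qᵍ-length : ∀ B → length (qᵍ B) ≤ 1
  qᵍ-length l0 = s≤s z≤n
  qᵍ-length l1 = s≤s z≤n
  qᵍ-length l2 = z≤n

  Prefix-singleton : ∀ p b → Prefix p (b ∷ []) → p ≢ [] → p ≡ b ∷ []
  Prefix-singleton [] b _ ne = ⊥-elim (ne refl)
  Prefix-singleton (x ∷ []) b (s , e) _ = cong (_∷ []) (sym (∷-injectiveˡ e))
  Prefix-singleton (x ∷ y ∷ p) b (s , ()) _

  return-framed-cases : ∀ t v N L R k → MarkerFree t → Palindrome v → Factor (L ++ N ++ R) (X k) → LeftBorder t L →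
    RightBorder (rev t) R → CompleteReturn (t ++ φ v ++ l2 ∷ rev t) (t ++ φ N ++ l2 ∷ rev t) →
    Palindrome (t ++ φ N ++ l2 ∷ rev t)
  return-framed-cases [] v N L R k ct pv fac lok rok ret = Palindrome-framed [] N
      (Lx-returnsPalindromic v N pv (Factor-X⇒Lx k (Factor-trans (L , R , refl) fac))
      (CompleteReturn-Φ⁻¹ v N ret))
  return-framed-cases (y ∷ t') v N L R k ct pv fac (inj₁ (() , _)) rok ret
  return-framed-cases (y ∷ t') v N L R k ct pv fac (inj₂ (b , refl , z , eb)) rok ret with suffix-BlockPiece b z
      (y ∷ t') eb (λ ()) | rok
  ... | piece-0 | inj₁ (() , _)
  ... | piece-1 | inj₁ (() , _)
  ... | piece-0 | inj₂ (b' , refl , pr') with EndsBlock-single l0 piece-0 b'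
      (Prefix-rev⇒EndsBlock (l0 ∷ []) b' pr')
  ...   | refl = Palindrome-framed (l0 ∷ []) N
      (Palindrome-inner l0 N l0 (Lx-returnsPalindromic (l0 ∷ v ++ [ l0 ]) _ (Palindrome-wrap l0 v pv)
      (Factor-X⇒Lx k fac)
                   (CompleteReturn-framed⁻¹ [ l0 ] v N l0 (λ ()) ct (z , eb)
                       (EndsBlock-single l0 piece-0) ret)))
  return-framed-cases (y ∷ t') v N L R k ct pv fac (inj₂ (b , refl , z , eb)) rok ret | piece-1 | inj₂
      (b' , refl , pr') with EndsBlock-single l1 piece-1 b' (Prefix-rev⇒EndsBlock (l1 ∷ []) b' pr')
  ...   | refl = Palindrome-framed (l1 ∷ []) N
      (Palindrome-inner l1 N l1 (Lx-returnsPalindromic (l1 ∷ v ++ [ l1 ]) _ (Palindrome-wrap l1 v pv)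
      (Factor-X⇒Lx k fac)
                   (CompleteReturn-framed⁻¹ [ l1 ] v N l1 (λ ()) ct (z , eb)
                       (EndsBlock-single l1 piece-1) ret)))

  Ly-returnsPalindromic : ReturnsPalindromic Ly
  Ly-returnsPalindromic [] w pp lw ret = CompleteReturn-[]⇒Palindrome w ret
  Ly-returnsPalindromic (x ∷ p) w pp (k , fw) ret with markerFree? w
  ... | yes cw with markerFree-Factor-Φ (X k) w fw cw
  ...   | inj₁ refl = refl
  ...   | inj₂ (B , fB) = length≤1⇒Palindrome w (≤-trans (length-Factor fB) (qᵍ-length B))
  Ly-returnsPalindromic (x ∷ p) w pp (k , fw) ret | no ncw with markerFree? (x ∷ p)
  Ly-returnsPalindromic (x ∷ p) w pp (k , fw) ret | no ncw | yes cp with parse (X k) w fw ncw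
  ... | t , N , t2 , L , R , refl , ct , ct2 , fac , lok , rok = by-borders lok rok
    where
    pt = proj₁ (CompleteReturn-markerFree-ends (x ∷ p) t N t2 cp ret)
    sp = proj₂ (CompleteReturn-markerFree-ends (x ∷ p) t N t2 cp ret)
    tne = Prefix-≢[] (x ∷ p) t (λ ()) pt
    t2ne = Suffix-≢[] (x ∷ p) t2 (λ ()) sp
    by-borders : LeftBorder t L → RightBorder t2 R → Palindrome (t ++ φ N ++ l2 ∷ t2)
    by-borders (inj₁ (te , _)) _ = ⊥-elim (tne te)
    by-borders (inj₂ _) (inj₁ (te , _)) = ⊥-elim (t2ne te)
    by-borders (inj₂ (b , eL , z , eb)) (inj₂ (b' , eR , (s' , eb'))) = by-pieces t t2 pt sp
        (suffix-BlockPiece b z t eb tne) (prefix-BlockPiece b' t2 s' eb' t2ne) eL eR fac ret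
      where
      by-pieces : ∀ t t2 → Prefix (x ∷ p) t → (Σ Word λ a' → t2 ≡ a' ++ (x ∷ p)) → BlockPiece b t →
        BlockPiece b' t2 → L ≡ [ b ] → R ≡ [ b' ] → Factor (L ++ N ++ R) (X k) →
        CompleteReturn (x ∷ p) (t ++ φ N ++ l2 ∷ t2) → Palindrome (t ++ φ N ++ l2 ∷ t2)
      by-pieces _ _ pt' (a' , ea') piece-0 piece-0 refl refl fac' ret' with Prefix-singleton (x ∷ p) l0 pt'
          (λ ())
      ... | refl = Palindrome-framed (l0 ∷ []) N
          (Palindrome-inner l0 N l0 (Lx-returnsPalindromic (l0 ∷ []) _ refl (Factor-X⇒Lx k fac')
          (CompleteReturn-block⁻¹ l0 N (λ ()) ret')))
      by-pieces _ _ pt' (a' , ea') piece-1 piece-1 refl refl fac' ret' with Prefix-singleton (x ∷ p) l1 pt'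
          (λ ())
      ... | refl = Palindrome-framed (l1 ∷ []) N
          (Palindrome-inner l1 N l1 (Lx-returnsPalindromic (l1 ∷ []) _ refl (Factor-X⇒Lx k fac')
          (CompleteReturn-block⁻¹ l1 N (λ ()) ret')))
      by-pieces _ _ pt' (a' , ea') piece-0 piece-1 refl refl fac' ret' with Prefix-singleton (x ∷ p) l0 pt'
          (λ ())
      ... | refl with proj₂ (∷ʳ-injective [] a' ea')
      ...   | ()
      by-pieces _ _ pt' (a' , ea') piece-1 piece-0 refl refl fac' ret' with Prefix-singleton (x ∷ p) l1 pt'
          (λ ())
      ... | refl with proj₂ (∷ʳ-injective [] a' ea')
      ...   | ()
  Ly-returnsPalindromic (x ∷ p) w pp (k , fw) ret | no ncw | no ncp with parseReturn (X k)
      (x ∷ p) w fw pp ncp ret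
  ... | t , v , N , L , R , ct , pv , ep , refl , fac , lok , rok = return-framed-cases t v N L R k ct pv fac lok rok (subst (λ q → CompleteReturn q _) ep ret)

  y-nth : ∀ n N → suc n ≤ N → y n ≡ nth (φ (X N)) n l0
  y-nth n N le = trans (cong (λ r → nth r n l0)
      (trans (cong (morph g) (map-applyUpTo x (λ k → k) (suc n))) (morph-g≡φ P)))
    (nth-Prefix (φ P) (φ (X N)) n l0 (let s , e = P-prefix in φ s , trans (cong φ e) (φ-++ P s))
      (≤-trans (≤-reflexive (sym (length-applyUpTo x (suc n)))) (length-φ P)))
    where
    P = applyUpTo x (suc n)
    P-prefix : Prefix P (X N)
    P-prefix = applyUpTo-Prefix x (suc n) (X N) (λ k lt → x-nth k N (≤-trans lt le))
                 (≤-trans le (≤-trans (n≤1+n N) (length-X N)))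

  window-y∈Ly : ∀ i m → Ly (window y i m)
  window-y∈Ly i m = i + m , Factor-trans
    (window-Factor y (φ (X (i + m))) i m (λ k lt → y-nth (i + k) (i + m) (+-monoʳ-< i lt))
      (≤-trans (n≤1+n (i + m)) (≤-trans (length-X (i + m)) (length-φ (X (i + m))))))
    (Prefix⇒Factor ([ l2 ] , refl))

corollary25 : Rich x × Rich y
corollary25 = windows⇒rich Lx-factorClosed Lx-returnsPalindromic x window-x∈Lx ,
              windows⇒rich Ly-factorClosed Ly-returnsPalindromic y window-y∈Ly
  where
  open FactorsOfX using (Lx-factorClosed; Lx-returnsPalindromic; window-x∈Lx)
  open FactorsOfY using (Ly-factorClosed; Ly-returnsPalindromic; window-y∈Ly)
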